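{- Let $r\geq 3$, let $m_i=u_iv_i$ with integers $u_i,v_i>1$ ($1\leq i\leq r$), let $G=\mathbb{Z}_{m_1}\times\dots\times\mathbb{Z}_{m_r}$, and let $g_i$ be the element of $G$ with $1$ in position $i$ and $0$ elsewhere. Let $\pi$ be a permutation of $\{1,\dots,r\}$ having no cycles of length $1$ or $2$. Define $$A=\{(k_1,\dots,k_r):0\leq k_i\leq u_i-1\},\qquad B'=\{(u_1k_1,\dots,u_rk_r):0\leq k_i\leq v_i-1\},$$ $B_i=\{ku_ig_i+u_{\pi(i)}g_{\pi(i)}:0\leq k\leq v_i-1\}$, and $$B=\left(B'\cup\bigcup_{i=1}^r(B_i+g_i)\right)\setminus\bigcup_{i=1}^rB_i.$$ Then $\Lambda_A=\{(v_1j_1,\dots,v_rj_r):0\leq j_i\leq u_i-1\}$ is a spectrum for $A$ in $G$, $\Lambda_B=\{(j_1,\dots,j_r):0\leq j_i\leq v_i-1\}$ is a spectrum for both $B'$ and $B$ in $G$, and $\Lambda_A\oplus\Lambda_B=G$.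
   Context: A finite subset $X$ of $G$ is spectral with spectrum $\Lambda\subset G$ (identifying $G$ with its dual via $\lambda\mapsto\chi_\lambda$, $\chi_\lambda(k)=\prod_{i=1}^re^{2\pi i k_i\lambda_i/m_i}$) if $\#\Lambda=\#X$ and $\frac{1}{\#X}\sum_{x\in X}\chi_\lambda(x)\overline{\chi_{\lambda'}(x)}=\delta_{\lambda\lambda'}$ for all $\lambda,\lambda'\in\Lambda$. $X\oplus Y=G$ means every element of $G$ is uniquely $x+y$ with $x\in X,y\in Y$. -}

module Defs where

open import Level using (0ℓ)
open import Data.Bool using (Bool; true; false; _∧_; _∨_; not; if_then_else_)
open import Data.Nat using (ℕ; zero; suc; _+_; _*_; _∸_; _<_; _≡ᵇ_; NonZero)
open import Data.Nat.DivMod using (_/_; _%_)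
open import Data.Fin using (Fin; _≟_)
import Data.Fin as Fin
open import Data.Fin.Permutation using (Permutation′; _⟨$⟩ʳ_)
open import Data.List using (List; []; _∷_; map; concatMap; upTo; allFin; filter; length; foldr)
open import Data.Vec.Functional using (Vector) renaming (_∷_ to _∷ᵛ_)
open import Data.Product using (Σ; ∃; _×_; _,_)
open import Data.Empty using (⊥)
open import Relation.Nullary using (¬_; does)
open import Relation.Binary.PropositionalEquality using (_≡_)
open import Algebra.Bundles using (CommutativeRing)
import Algebra.Bundles
open import Data.Bool.ListAction using (any; all)

-- Raw integer vectors of length r; an element of G = Z_{m_1} x ... x Z_{m_r}
-- is represented by such a vector, equality being coordinatewise mod m_i.
Elt : ℕ → Set
Elt r = Vector ℕ r

enum : (r : ℕ) → Vector ℕ r → List (Elt r)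
enum zero    b = (λ ()) ∷ []
enum (suc r) b = concatMap (λ k → map (λ f → k ∷ᵛ f) (enum r (λ i → b (Fin.suc i)))) (upTo (b Fin.zero))

_⊕ᵉ_ : ∀ {r} → Elt r → Elt r → Elt r
(x ⊕ᵉ y) i = x i + y i

unit : ∀ {r} → Fin r → Elt r
unit i j = if does (i ≟ j) then 1 else 0

_·ᵉ_ : ∀ {r} → ℕ → Elt r → Elt r
(k ·ᵉ x) i = k * x i

prod : ∀ {r} → Vector ℕ r → ℕ
prod {r} m = foldr (λ i acc → m i * acc) 1 (allFin r)

sumℕ : ∀ {r} → Vector ℕ r → ℕ
sumℕ {r} f = foldr (λ i acc → f i + acc) 0 (allFin r)

Subset : ℕ → Set
Subset r = Elt r → Bool

module Group (r : ℕ) (m : Vector ℕ r) (nz : ∀ i → NonZero (m i)) where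

  InG : Elt r → Set
  InG x = ∀ i → x i < m i

  allG : List (Elt r)
  allG = enum r m

  eqG : Elt r → Elt r → Bool
  eqG x y = all (λ i → (_%_ (x i) (m i) ⦃ nz i ⦄) ≡ᵇ (_%_ (y i) (m i) ⦃ nz i ⦄)) (allFin r)

  fromList : List (Elt r) → Subset r
  fromList xs x = any (eqG x) xs

  card : Subset r → ℕ
  card X = length (filter (λ x → X x ≡ᵇ' true) allG)
    where
    open import Data.Bool.Properties using () renaming (_≟_ to _≡ᵇ'_)

  N : ℕ
  N = prod m

  -- chi_lam(x) * conj(chi_lam'(x)) = zeta ^ pairExp x lam lam' where zeta is a
  -- primitive N-th root of unity, N = m_1 ... m_r; e^{2 pi i/m_i} = zeta^(N/m_i),
  -- and conj(e^{2 pi i a/m_i}) = e^{2 pi i (m_i - a)/m_i} for 0 ≤ a < m_i.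
  pairExp : Elt r → Elt r → Elt r → ℕ
  pairExp x lam lam' =
    sumℕ (λ i → (_/_ N (m i) ⦃ nz i ⦄) * (x i * (lam i + (m i ∸ lam' i))))

  -- Spectrality: #Λ = #X and orthogonality of the characters chi_λ (λ ∈ Λ) on X,
  -- i.e. Σ_{x∈X} χ_λ(x) conj(χ_λ'(x)) = δ_{λλ'} · #X, with the characters valued in
  -- any characteristic-0 integral domain containing a primitive N-th root of unity ζ
  -- (standing in for C with ζ = e^{2πi/N}).
  module _ (R : CommutativeRing 0ℓ 0ℓ) where
    open CommutativeRing R using (Carrier; _≈_; 0#; 1#; semiring) renaming (_*_ to _*ᴿ_; _+_ to _+ᴿ_)
    open import Algebra.Definitions.RawSemiring (Algebra.Bundles.Semiring.rawSemiring semiring) using (_^_) renaming (_×_ to _·ᴿ_)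

    IntegralDomain : Set
    IntegralDomain = (a b : Carrier) → a *ᴿ b ≈ 0# → (a ≈ 0#) Data.Sum.⊎ (b ≈ 0#)
      where import Data.Sum

    CharZero : Set
    CharZero = (n : ℕ) → n ·ᴿ 1# ≈ 0# → n ≡ 0

    PrimitiveRoot : Carrier → Set
    PrimitiveRoot ζ = (ζ ^ N ≈ 1#) × ((k : ℕ) → 0 < k → k < N → ¬ (ζ ^ k ≈ 1#))

    sumOver : Subset r → (Elt r → Carrier) → Carrier
    sumOver X f = foldr (λ x acc → (if X x then f x else 0#) +ᴿ acc) 0# allG

    Orthogonal : Carrier → Subset r → Subset r → Set
    Orthogonal ζ X Λ = (lam lam' : Elt r) → InG lam → InG lam' → Λ lam ≡ true → Λ lam' ≡ true →
      sumOver X (λ x → ζ ^ pairExp x lam lam') ≈ (if eqG lam lam' then card X ·ᴿ 1# else 0#)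

  Spectral : Subset r → Subset r → Set₁
  Spectral X Λ = (card Λ ≡ card X) ×
    ((R : CommutativeRing 0ℓ 0ℓ) → IntegralDomain R → CharZero R →
     (ζ : CommutativeRing.Carrier R) → PrimitiveRoot R ζ → Orthogonal R ζ X Λ)

  DirectSumIsG : Subset r → Subset r → Set
  DirectSumIsG X Y =
    ((g : Elt r) → InG g → Σ (Elt r) λ x → Σ (Elt r) λ y →
       InG x × InG y × X x ≡ true × Y y ≡ true × eqG (x ⊕ᵉ y) g ≡ true)
    × ((x y x' y' : Elt r) → InG x → InG y → InG x' → InG y' →
       X x ≡ true → Y y ≡ true → X x' ≡ true → Y y' ≡ true →
       eqG (x ⊕ᵉ y) (x' ⊕ᵉ y') ≡ true → (eqG x x' ≡ true) × (eqG y y' ≡ true))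

NoShortCycles : ∀ {r} → Permutation′ r → Set
NoShortCycles π = ∀ i → ¬ (π ⟨$⟩ʳ i ≡ i) × ¬ (π ⟨$⟩ʳ (π ⟨$⟩ʳ i) ≡ i)

module Sets (r : ℕ) (u v : Vector ℕ r) (π : Permutation′ r)
            (nz : ∀ i → NonZero (u i * v i)) where
  m : Vector ℕ r
  m i = u i * v i
  open Group r m nz public

  A : Subset r
  A = fromList (enum r u)

  B′ : Subset r
  B′ = fromList (map (λ k i → u i * k i) (enum r v))

  Blist : Fin r → List (Elt r)
  Blist i = map (λ k → ((k * u i) ·ᵉ unit i) ⊕ᵉ (u (π ⟨$⟩ʳ i) ·ᵉ unit (π ⟨$⟩ʳ i))) (upTo (v i))

  Bi : Fin r → Subset r
  Bi i = fromList (Blist i)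

  Bi+gi : Fin r → Subset r
  Bi+gi i = fromList (map (λ b → b ⊕ᵉ unit i) (Blist i))

  B : Subset r
  B x = (B′ x ∨ any (λ i → Bi+gi i x) (allFin r)) ∧ not (any (λ i → Bi i x) (allFin r))

  ΛA : Subset r
  ΛA = fromList (map (λ j i → v i * j i) (enum r u))

  ΛB : Subset r
  ΛB = fromList (enum r v)

nzProd : ∀ {r} (u v : Vector ℕ r) → (∀ i → 1 < u i) → (∀ i → 1 < v i) → ∀ i → NonZero (u i * v i)
nzProd u v hu hv i = Data.Nat.>-nonZero (Data.Nat.Properties.*-mono-< {0} {u i} {0} {v i} (Data.Nat.Properties.<-trans (Data.Nat.s≤s Data.Nat.z≤n) (hu i)) (Data.Nat.Properties.<-trans (Data.Nat.s≤s Data.Nat.z≤n) (hv i)))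
  where import Data.Nat; import Data.Nat.Properties

-- Characters of G are powers of a primitive N-th root of unity ζ in an integral domain, and a
-- character sum over any of the sets is a sum over an explicit list of distinct representatives.
-- For A and B′ (boxes, up to coordinatewise scaling) it factors into one-dimensional geometric
-- sums, one of which vanishes when λ ≠ λ′. For B: the Bᵢ lie in B′ and are pairwise disjoint
-- (π has no 1- or 2-cycles), and so are the translates Bᵢ + gᵢ, which miss B′; hence
-- 1_B + Σᵢ 1_{Bᵢ} = 1_{B′} + Σᵢ 1_{Bᵢ+gᵢ}. The sum of χ over Bᵢ + gᵢ is χ(gᵢ) times its sum over
-- Bᵢ, and either χ(gᵢ) = 1 or the sum over Bᵢ vanishes, so the character sums over B and B′
-- agree; cardinalities are compared the same way, summing 1 in ℤ. Finally ΛA ⊕ ΛB = G is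
-- division with remainder by vᵢ in each coordinate.
module Submission where

open import Defs
open import Data.Nat using (ℕ; _≤_; _<_)
open import Data.Fin.Permutation using (Permutation′)
open import Data.Vec.Functional using (Vector)
open import Data.Product using (_×_)

open import Level using (0ℓ)
open import Algebra.Bundles using (CommutativeRing)
import Algebra.Bundles
open import Data.Bool using (Bool; true; false; if_then_else_; _∨_; _∧_; not)
open import Data.Bool.ListAction using (any)
open import Data.Bool.Properties using (T-≡) renaming (_≟_ to _≟ᵇ_)
open import Data.Empty using (⊥)
open import Data.Fin as Fin using (Fin; _≟_)
open import Data.Fin.Permutation using (_⟨$⟩ʳ_; _⟨$⟩ˡ_; inverseˡ)
open import Data.Fin.Properties using (¬∀⟶∃¬; suc-injective)
open import Data.Integer as ℤ using (ℤ; 1ℤ)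
open import Data.Integer.Properties as ℤ using () renaming (+-*-commutativeRing to ℤ-ring)
open import Data.List using (List; []; _∷_; _++_; _∷ʳ_; map; concatMap; foldr; filter; length; upTo; applyUpTo; allFin)
open import Data.List.Properties using (foldr-map; map-tabulate; upTo-∷ʳ; map-applyUpTo)
open import Data.List.Membership.Propositional using (_∈_; find)
open import Data.List.Membership.Propositional.Properties
  using (∈-map⁺; ∈-map⁻; ∈-concatMap⁺; ∈-concatMap⁻; ∈-upTo⁺; ∈-upTo⁻; ∈-allFin)
open import Data.List.Relation.Unary.All as All using (All)
import Data.List.Relation.Unary.All.Properties as All
open import Data.List.Relation.Unary.Any as Any using (here; there)
import Data.List.Relation.Unary.Any.Properties as Any
open import Data.List.Relation.Unary.AllPairs as AllPairs using (AllPairs)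
import Data.List.Relation.Unary.AllPairs.Properties as AllPairs
open import Data.List.Relation.Unary.Unique.Propositional using (Unique)
open import Data.List.Relation.Unary.Unique.Propositional.Properties using (upTo⁺; allFin⁺)
open import Data.Nat as ℕ using (zero; suc; _+_; _*_; _∸_; NonZero; >-nonZero; s≤s; z≤n)
import Data.Nat.Properties as ℕ
open import Data.Nat.DivMod
  using (_/_; _%_; [m+kn]%n≡m%n; m<n⇒m%n≡m; m%n<n; m≡m%n+[m/n]*n; m/n*n≡m; m<n*o⇒m/o<n)
open import Data.Nat.Divisibility
  using (_∣_; divides; ∣-refl; ∣m⇒∣m*n; ∣n⇒∣m*n; ∣m∣n⇒∣m+n; *-cancelˡ-∣; m%n≡0⇒n∣m)
open import Data.Nat.Tactic.RingSolver using (solve-∀)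
open import Data.Product using (∃; _,_; proj₁; proj₂)
open import Data.Sum using (_⊎_; inj₁; inj₂)
open import Data.Vec.Functional using (tail) renaming (_∷_ to _∷ᵛ_)
open import Function using (_∘_; id; Equivalence)
open import Relation.Binary.Core using (_Preserves_⟶_)
open import Relation.Nullary using (¬_; Dec; yes; no; contradiction)
open import Relation.Nullary.Decidable using (dec-true; dec-false)
import Relation.Binary.PropositionalEquality as ≡
open ≡ using (_≡_; _≢_; _≗_)

infix 4 _<ᵛ_

_<ᵛ_ : ∀ {r} → Elt r → Vector ℕ r → Set
x <ᵛ b = ∀ i → x i < b i

_·ᵛ_ : ∀ {r} → Vector ℕ r → Elt r → Elt r
(a ·ᵛ k) i = a i * k i

Distinct : ∀ {r} → List (Elt r) → Set
Distinct = AllPairs (λ x y → ¬ x ≗ y)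

∈-enum-suc⁻ : ∀ r (b : Vector ℕ (suc r)) {x} → x ∈ enum (suc r) b →
  ∃ λ t → ∃ λ f → t < b Fin.zero × f ∈ enum r (tail b) × x ≡ t ∷ᵛ f
∈-enum-suc⁻ r b x∈ with find (∈-concatMap⁻ _ {xs = upTo (b Fin.zero)} x∈)
... | t , t∈ , x∈t with ∈-map⁻ (t ∷ᵛ_) x∈t
... | f , f∈ , ≡.refl = t , f , ∈-upTo⁻ t∈ , f∈ , ≡.refl

∈-enum⁻ : ∀ r (b : Vector ℕ r) {x} → x ∈ enum r b → x <ᵛ b
∈-enum⁻ (suc r) b x∈ i with ∈-enum-suc⁻ r b x∈
∈-enum⁻ (suc r) b x∈ Fin.zero    | _ , _ , t<b , _ , ≡.refl = t<b
∈-enum⁻ (suc r) b x∈ (Fin.suc i) | _ , _ , _ , f∈ , ≡.refl = ∈-enum⁻ r (tail b) f∈ i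

∈-enum⁺ : ∀ r (b : Vector ℕ r) {k} → k <ᵛ b → ∃ λ x → x ∈ enum r b × x ≗ k
∈-enum⁺ zero    b k<b = _ , here ≡.refl , λ ()
∈-enum⁺ (suc r) b {k} k<b with ∈-enum⁺ r (tail b) (k<b ∘ Fin.suc)
... | f , f∈ , f≗ = k Fin.zero ∷ᵛ f ,
  ∈-concatMap⁺ _ (Any.map (λ { ≡.refl → ∈-map⁺ (k Fin.zero ∷ᵛ_) f∈ }) (∈-upTo⁺ (k<b Fin.zero))) ,
  λ { Fin.zero → ≡.refl ; (Fin.suc i) → f≗ i }

enum-distinct : ∀ r (b : Vector ℕ r) → Distinct (enum r b)
enum-distinct zero    b = All.[] AllPairs.∷ AllPairs.[]
enum-distinct (suc r) b = AllPairs.concat⁺ {xss = map slice (upTo (b Fin.zero))}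
  (All.map⁺ (All.universal slice-distinct _))
  (AllPairs.map⁺ (AllPairs.applyUpTo⁺₁ id _ (λ s<t _ → slices-disjoint (ℕ.<⇒≢ s<t))))
  where
  slice : ℕ → List (Elt (suc r))
  slice t = map (t ∷ᵛ_) (enum r (tail b))

  slice-distinct : ∀ t → Distinct (slice t)
  slice-distinct t = AllPairs.map⁺
    (AllPairs.map (λ f≉g t∷f≗t∷g → f≉g (t∷f≗t∷g ∘ Fin.suc)) (enum-distinct r (tail b)))

  slices-disjoint : ∀ {s t} → s ≢ t → All (λ x → All (λ y → ¬ x ≗ y) (slice t)) (slice s)
  slices-disjoint s≢t =
    All.map⁺ (All.universal (λ _ → All.map⁺ (All.universal (λ _ x≗y → s≢t (x≗y Fin.zero)) _)) _)

sumℕ-suc : ∀ {r} (f : Vector ℕ (suc r)) → sumℕ f ≡ f Fin.zero + sumℕ (tail f)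
sumℕ-suc {r} f = ≡.cong (f Fin.zero +_) (≡.trans
  (≡.cong (foldr (λ i acc → f i + acc) 0) (≡.sym (map-tabulate (λ i → i) Fin.suc)))
  (foldr-map (λ i acc → f i + acc) Fin.suc 0 (allFin r)))

sumℕ-cong : ∀ {r} {f g : Vector ℕ r} → f ≗ g → sumℕ f ≡ sumℕ g
sumℕ-cong {zero}  f≗g = ≡.refl
sumℕ-cong {suc r} {f} {g} f≗g = begin
  sumℕ f                      ≡⟨ sumℕ-suc f ⟩
  f Fin.zero + sumℕ (tail f)  ≡⟨ ≡.cong₂ _+_ (f≗g Fin.zero) (sumℕ-cong (f≗g ∘ Fin.suc)) ⟩
  g Fin.zero + sumℕ (tail g)  ≡⟨ ≡.sym (sumℕ-suc g) ⟩
  sumℕ g                      ∎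
  where open ≡.≡-Reasoning

sumℕ-zero : ∀ {r} {f : Vector ℕ r} → (∀ i → f i ≡ 0) → sumℕ f ≡ 0
sumℕ-zero {zero}  f≡0 = ≡.refl
sumℕ-zero {suc r} {f} f≡0 = ≡.trans (sumℕ-suc f) (≡.cong₂ _+_ (f≡0 Fin.zero) (sumℕ-zero (f≡0 ∘ Fin.suc)))

sumℕ-single : ∀ {r} (f : Vector ℕ r) i → (∀ j → j ≢ i → f j ≡ 0) → sumℕ f ≡ f i
sumℕ-single {suc r} f Fin.zero    f≡0 = ≡.trans (sumℕ-suc f)
  (≡.trans (≡.cong (f Fin.zero +_) (sumℕ-zero (λ j → f≡0 (Fin.suc j) λ ()))) (ℕ.+-identityʳ _))
sumℕ-single {suc r} f (Fin.suc i) f≡0 = ≡.trans (sumℕ-suc f) (≡.cong₂ _+_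
  (f≡0 Fin.zero λ ())
  (sumℕ-single (tail f) i (λ j j≢i → f≡0 (Fin.suc j) (j≢i ∘ suc-injective))))

sumℕ-+ : ∀ {r} (f g : Vector ℕ r) → sumℕ (λ i → f i + g i) ≡ sumℕ f + sumℕ g
sumℕ-+ {zero}  f g = ≡.refl
sumℕ-+ {suc r} f g = begin
  sumℕ (λ i → f i + g i)                        ≡⟨ sumℕ-suc (λ i → f i + g i) ⟩
  (f₀ + g₀) + sumℕ (λ i → tail f i + tail g i)  ≡⟨ ≡.cong ((f₀ + g₀) +_) (sumℕ-+ (tail f) (tail g)) ⟩
  (f₀ + g₀) + (sumℕ (tail f) + sumℕ (tail g))   ≡⟨ shuffle f₀ g₀ (sumℕ (tail f)) (sumℕ (tail g)) ⟩
  (f₀ + sumℕ (tail f)) + (g₀ + sumℕ (tail g))   ≡⟨ ≡.cong₂ _+_ (sumℕ-suc f) (sumℕ-suc g) ⟨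
  sumℕ f + sumℕ g                               ∎
  where
  open ≡.≡-Reasoning
  f₀ = f Fin.zero
  g₀ = g Fin.zero
  shuffle : ∀ a b c d → (a + b) + (c + d) ≡ (a + c) + (b + d)
  shuffle = solve-∀

∣-sumℕ : ∀ {r} {d} (f : Vector ℕ r) → (∀ i → d ∣ f i) → d ∣ sumℕ f
∣-sumℕ {zero}  f d∣f = divides 0 ≡.refl
∣-sumℕ {suc r} f d∣f rewrite sumℕ-suc f = ∣m∣n⇒∣m+n (d∣f Fin.zero) (∣-sumℕ (tail f) (d∣f ∘ Fin.suc))

residue-unique : ∀ {n x y} a b → x < n → y < n → x + a * n ≡ y + b * n → x ≡ y
residue-unique {n} {x} {y} a b x<n y<n eq = begin
  x                   ≡⟨ ≡.sym (m<n⇒m%n≡m x<n) ⟩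
  x % n               ≡⟨ ≡.sym ([m+kn]%n≡m%n x a n) ⟩
  (x + a * n) % n     ≡⟨ ≡.cong (_% n) eq ⟩
  (y + b * n) % n     ≡⟨ [m+kn]%n≡m%n y b n ⟩
  y % n               ≡⟨ m<n⇒m%n≡m y<n ⟩
  y                   ∎
  where
  open ≡.≡-Reasoning
  instance
    n≢0 : NonZero n
    n≢0 = >-nonZero (ℕ.<-≤-trans (s≤s z≤n) x<n)

x≢y⇒∤x+[c∸y] : ∀ {n x y c} → x < n → y < n → x ≢ y → n ∣ c → y ≤ c → ¬ n ∣ x + (c ∸ y)
x≢y⇒∤x+[c∸y] {n} {x} {y} {c} x<n y<n x≢y (divides p ≡.refl) y≤c (divides q eq) =
  x≢y (residue-unique p q x<n y<n (begin
    x + p * n              ≡⟨ ≡.cong (x +_) (≡.sym (ℕ.m∸n+n≡m y≤c)) ⟩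
    x + ((p * n ∸ y) + y)  ≡⟨ ≡.sym (ℕ.+-assoc x _ y) ⟩
    (x + (p * n ∸ y)) + y  ≡⟨ ≡.cong (_+ y) eq ⟩
    q * n + y              ≡⟨ ℕ.+-comm (q * n) y ⟩
    y + q * n              ∎))
  where open ≡.≡-Reasoning

any≡true⁻ : ∀ {A : Set} (X : A → Bool) xs → any X xs ≡ true → ∃ λ x → x ∈ xs × X x ≡ true
any≡true⁻ X xs any≡true with find (Any.any⁻ X xs (Equivalence.from T-≡ any≡true))
... | x , x∈xs , Xx = x , x∈xs , Equivalence.to T-≡ Xx

unit-diag : ∀ {r} (i : Fin r) → unit i i ≡ 1
unit-diag i = ≡.cong (if_then 1 else 0) (dec-true (i ≟ i) ≡.refl)

unit-off : ∀ {r} {i j : Fin r} → i ≢ j → unit i j ≡ 0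
unit-off {i = i} {j} i≢j = ≡.cong (if_then 1 else 0) (dec-false (i ≟ j) i≢j)

unit-scale : ∀ {r} (w : Vector ℕ r) (i j : Fin r) → w j * unit i j ≡ w i * unit i j
unit-scale w i j with i ≟ j
... | yes ≡.refl = ≡.refl
... | no _       = ≡.trans (ℕ.*-zeroʳ (w j)) (≡.sym (ℕ.*-zeroʳ (w i)))

module ListSum (R : CommutativeRing 0ℓ 0ℓ) where
  open CommutativeRing R renaming (_+_ to _+ᴿ_; _*_ to _*ᴿ_)
  open import Relation.Binary.Reasoning.Setoid setoid

  ∑ : {A : Set} → List A → (A → Carrier) → Carrier
  ∑ xs f = foldr (λ x acc → f x +ᴿ acc) 0# xs

  private variable A B : Set

  ∑-cong : (xs : List A) {f g : A → Carrier} → (∀ {x} → x ∈ xs → f x ≈ g x) → ∑ xs f ≈ ∑ xs g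
  ∑-cong []       f≈g = refl
  ∑-cong (x ∷ xs) f≈g = +-cong (f≈g (here ≡.refl)) (∑-cong xs (f≈g ∘ there))

  ∑-zero : (xs : List A) {f : A → Carrier} → (∀ {x} → x ∈ xs → f x ≈ 0#) → ∑ xs f ≈ 0#
  ∑-zero []       f≈0 = refl
  ∑-zero (x ∷ xs) f≈0 = trans (+-cong (f≈0 (here ≡.refl)) (∑-zero xs (f≈0 ∘ there))) (+-identityˡ 0#)

  ∑-++ : (xs ys : List A) (f : A → Carrier) → ∑ (xs ++ ys) f ≈ ∑ xs f +ᴿ ∑ ys f
  ∑-++ []       ys f = sym (+-identityˡ _)
  ∑-++ (x ∷ xs) ys f = trans (+-congˡ (∑-++ xs ys f)) (sym (+-assoc _ _ _))

  ∑-+ : (xs : List A) (f g : A → Carrier) → ∑ xs (λ x → f x +ᴿ g x) ≈ ∑ xs f +ᴿ ∑ xs g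
  ∑-+ []       f g = sym (+-identityˡ 0#)
  ∑-+ (x ∷ xs) f g = begin
    (f x +ᴿ g x) +ᴿ ∑ xs (λ x → f x +ᴿ g x) ≈⟨ +-congˡ (∑-+ xs f g) ⟩
    (f x +ᴿ g x) +ᴿ (∑ xs f +ᴿ ∑ xs g)      ≈⟨ +-assoc _ _ _ ⟩
    f x +ᴿ (g x +ᴿ (∑ xs f +ᴿ ∑ xs g))      ≈⟨ +-congˡ (+-comm _ _) ⟩
    f x +ᴿ ((∑ xs f +ᴿ ∑ xs g) +ᴿ g x)      ≈⟨ +-congˡ (+-assoc _ _ _) ⟩
    f x +ᴿ (∑ xs f +ᴿ (∑ xs g +ᴿ g x))      ≈⟨ +-congˡ (+-congˡ (+-comm _ _)) ⟩
    f x +ᴿ (∑ xs f +ᴿ (g x +ᴿ ∑ xs g))      ≈⟨ sym (+-assoc _ _ _) ⟩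
    (f x +ᴿ ∑ xs f) +ᴿ (g x +ᴿ ∑ xs g)      ∎

  ∑-*ˡ : (xs : List A) (c : Carrier) (f : A → Carrier) → ∑ xs (λ x → c *ᴿ f x) ≈ c *ᴿ ∑ xs f
  ∑-*ˡ []       c f = sym (zeroʳ c)
  ∑-*ˡ (x ∷ xs) c f = trans (+-congˡ (∑-*ˡ xs c f)) (sym (distribˡ c _ _))

  ∑-*ʳ : (xs : List A) (c : Carrier) (f : A → Carrier) → ∑ xs (λ x → f x *ᴿ c) ≈ ∑ xs f *ᴿ c
  ∑-*ʳ []       c f = sym (zeroˡ c)
  ∑-*ʳ (x ∷ xs) c f = trans (+-congˡ (∑-*ʳ xs c f)) (sym (distribʳ c _ _))

  ∑-map : (h : A → B) (xs : List A) (f : B → Carrier) → ∑ (map h xs) f ≡ ∑ xs (f ∘ h)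
  ∑-map h []       f = ≡.refl
  ∑-map h (x ∷ xs) f = ≡.cong (f (h x) +ᴿ_) (∑-map h xs f)

  ∑-concatMap : (g : A → List B) (xs : List A) (f : B → Carrier) →
    ∑ (concatMap g xs) f ≈ ∑ xs (λ x → ∑ (g x) f)
  ∑-concatMap g []       f = refl
  ∑-concatMap g (x ∷ xs) f = trans (∑-++ (g x) (concatMap g xs) f) (+-congˡ (∑-concatMap g xs f))

  ∑-swap : (xs : List A) (ys : List B) (h : A → B → Carrier) →
    ∑ xs (λ x → ∑ ys (h x)) ≈ ∑ ys (λ y → ∑ xs (λ x → h x y))
  ∑-swap []       ys h = sym (∑-zero ys (λ _ → refl))
  ∑-swap (x ∷ xs) ys h = trans (+-congˡ (∑-swap xs ys h)) (sym (∑-+ ys (h x) _))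

  ∑-if-unique : (xs : List A) (X : A → Bool) (c : Carrier) → Unique xs →
    (∀ {x y} → X x ≡ true → X y ≡ true → x ≡ y) →
    ∑ xs (λ x → if X x then c else 0#) ≈ (if any X xs then c else 0#)
  ∑-if-unique []       X c _            X-unique = refl
  ∑-if-unique (x ∷ xs) X c (x∉xs AllPairs.∷ xs!) X-unique with X x in Xx
  ... | true  = trans (+-congˡ (∑-zero xs X-false)) (+-identityʳ c)
    where
    X-false : ∀ {y} → y ∈ xs → (if X y then c else 0#) ≈ 0#
    X-false {y} y∈xs with X y in Xy
    ... | false = refl
    ... | true  = contradiction (X-unique Xx Xy) (All.lookup x∉xs y∈xs)
  ... | false = trans (+-identityˡ _) (∑-if-unique xs X c xs! X-unique)

  ∑-select : ∀ {r} (xs : List (Elt r)) (D : Elt r → Bool) (f : Elt r → Carrier) {l} →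
    Distinct xs → l ∈ xs → D l ≡ true → (∀ {x} → x ∈ xs → D x ≡ true → x ≗ l) →
    ∑ xs (λ x → if D x then f x else 0#) ≈ f l
  ∑-select (x ∷ xs) D f (x≉xs AllPairs.∷ _) (here ≡.refl) Dx D⇒≗ =
    trans (+-cong (reflexive (≡.cong (if_then f x else 0#) Dx)) (∑-zero xs D-false)) (+-identityʳ (f x))
    where
    D-false : ∀ {y} → y ∈ xs → (if D y then f y else 0#) ≈ 0#
    D-false {y} y∈xs with D y in Dy
    ... | false = refl
    ... | true  = contradiction (≡.sym ∘ D⇒≗ (there y∈xs) Dy) (All.lookup x≉xs y∈xs)
  ∑-select (x ∷ xs) D f (x≉xs AllPairs.∷ xs≉) (there l∈xs) Dl D⇒≗ with D x in Dx
  ... | false = trans (+-identityˡ _) (∑-select xs D f xs≉ l∈xs Dl (D⇒≗ ∘ there))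
  ... | true  = contradiction (D⇒≗ (here ≡.refl) Dx) (All.lookup x≉xs l∈xs)

module Powers (R : CommutativeRing 0ℓ 0ℓ) where
  open CommutativeRing R renaming (_+_ to _+ᴿ_; _*_ to _*ᴿ_)
  open ListSum R
  open import Algebra.Definitions.RawSemiring (Algebra.Bundles.Semiring.rawSemiring semiring) using (_^_)
  open import Algebra.Properties.Semiring.Exp semiring using (^-homo-*; ^-assocʳ; ^-congʳ; ^-congˡ)
  open import Algebra.Properties.Group +-group using (∙-cancelˡ; x∙y⁻¹≈ε⇒x≈y)
  open import Algebra.Properties.Ring ring using (-1*x≈-x)
  open import Relation.Binary.Reasoning.Setoid setoid

  1^n≈1 : ∀ n → 1# ^ n ≈ 1#
  1^n≈1 zero    = refl
  1^n≈1 (suc n) = trans (*-identityˡ _) (1^n≈1 n)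

  ∑-upTo-suc-^ : ∀ ω n → ∑ (upTo (suc n)) (ω ^_) ≈ 1# +ᴿ ω *ᴿ ∑ (upTo n) (ω ^_)
  ∑-upTo-suc-^ ω n = +-congˡ (begin
    ∑ (applyUpTo suc n) (ω ^_)      ≡⟨ ≡.cong (λ ts → ∑ ts (ω ^_)) (map-applyUpTo id suc n) ⟨
    ∑ (map suc (upTo n)) (ω ^_)     ≡⟨ ∑-map suc (upTo n) (ω ^_) ⟩
    ∑ (upTo n) (λ t → ω *ᴿ ω ^ t)   ≈⟨ ∑-*ˡ (upTo n) ω (ω ^_) ⟩
    ω *ᴿ ∑ (upTo n) (ω ^_)          ∎)

  ∑-upTo-∷ʳ-^ : ∀ ω n → ∑ (upTo (suc n)) (ω ^_) ≈ ∑ (upTo n) (ω ^_) +ᴿ ω ^ n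
  ∑-upTo-∷ʳ-^ ω n = begin
    ∑ (upTo (suc n)) (ω ^_)             ≡⟨ ≡.cong (λ ts → ∑ ts (ω ^_)) (upTo-∷ʳ n) ⟨
    ∑ (upTo n ∷ʳ n) (ω ^_)              ≈⟨ ∑-++ (upTo n) (n ∷ []) (ω ^_) ⟩
    ∑ (upTo n) (ω ^_) +ᴿ (ω ^ n +ᴿ 0#)  ≈⟨ +-congˡ (+-identityʳ _) ⟩
    ∑ (upTo n) (ω ^_) +ᴿ ω ^ n          ∎

  module _ (integral : ∀ a b → a *ᴿ b ≈ 0# → a ≈ 0# ⊎ b ≈ 0#) where

    geometric-sum≈0 : ∀ ω n → ω ^ n ≈ 1# → ¬ ω ≈ 1# → ∑ (upTo n) (ω ^_) ≈ 0#
    geometric-sum≈0 ω n ωⁿ≈1 ω≉1 with integral (ω - 1#) S [ω-1]S≈0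
      where
      S = ∑ (upTo n) (ω ^_)
      ωS≈S : ω *ᴿ S ≈ S
      ωS≈S = ∙-cancelˡ 1# _ _ (begin
        1# +ᴿ ω *ᴿ S             ≈⟨ ∑-upTo-suc-^ ω n ⟨
        ∑ (upTo (suc n)) (ω ^_)  ≈⟨ ∑-upTo-∷ʳ-^ ω n ⟩
        S +ᴿ ω ^ n               ≈⟨ +-congˡ ωⁿ≈1 ⟩
        S +ᴿ 1#                  ≈⟨ +-comm S 1# ⟩
        1# +ᴿ S                  ∎)
      [ω-1]S≈0 : (ω - 1#) *ᴿ S ≈ 0#
      [ω-1]S≈0 = begin
        (ω - 1#) *ᴿ S          ≈⟨ distribʳ S ω (- 1#) ⟩
        ω *ᴿ S +ᴿ - 1# *ᴿ S    ≈⟨ +-cong ωS≈S (-1*x≈-x S) ⟩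
        S - S                  ≈⟨ -‿inverseʳ S ⟩
        0#                     ∎
    ... | inj₁ ω-1≈0 = contradiction (x∙y⁻¹≈ε⇒x≈y ω 1# ω-1≈0) ω≉1
    ... | inj₂ S≈0   = S≈0

  module _ (ζ : Carrier) (N : ℕ) ⦃ _ : NonZero N ⦄ (ζᴺ≈1 : ζ ^ N ≈ 1#)
           (ζᵏ≉1 : ∀ k → 0 < k → k < N → ¬ ζ ^ k ≈ 1#) where

    ∣⇒^≈1 : ∀ {e} → N ∣ e → ζ ^ e ≈ 1#
    ∣⇒^≈1 (divides q ≡.refl) = begin
      ζ ^ (q * N)  ≈⟨ ^-congʳ ζ (ℕ.*-comm q N) ⟩
      ζ ^ (N * q)  ≈⟨ ^-assocʳ ζ N q ⟨
      (ζ ^ N) ^ q  ≈⟨ ^-congˡ q ζᴺ≈1 ⟩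
      1# ^ q       ≈⟨ 1^n≈1 q ⟩
      1#           ∎

    ^≈1⇒∣ : ∀ {e} → ζ ^ e ≈ 1# → N ∣ e
    ^≈1⇒∣ {e} ζᵉ≈1 with e % N in e%N
    ... | zero  = m%n≡0⇒n∣m e N e%N
    ... | suc k = contradiction ζ¹⁺ᵏ≈1 (ζᵏ≉1 (suc k) (s≤s z≤n) (≡.subst (_< N) e%N (m%n<n e N)))
      where
      ζ¹⁺ᵏ≈1 : ζ ^ suc k ≈ 1#
      ζ¹⁺ᵏ≈1 = begin
        ζ ^ suc k                       ≈⟨ *-identityʳ _ ⟨
        ζ ^ suc k *ᴿ 1#                 ≈⟨ *-congˡ (∣⇒^≈1 (divides (e / N) ≡.refl)) ⟨
        ζ ^ suc k *ᴿ ζ ^ (e / N * N)    ≈⟨ ^-homo-* ζ (suc k) _ ⟨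
        ζ ^ (suc k + e / N * N)         ≈⟨ ^-congʳ ζ (≡.cong (_+ e / N * N) e%N) ⟨
        ζ ^ (e % N + e / N * N)         ≈⟨ ^-congʳ ζ (m≡m%n+[m/n]*n e N) ⟨
        ζ ^ e                           ≈⟨ ζᵉ≈1 ⟩
        1#                              ∎

  ∑-enum-^-linear : ∀ x r (b c : Vector ℕ (suc r)) →
    ∑ (enum (suc r) b) (λ k → x ^ sumℕ (λ j → c j * k j)) ≈
    ∑ (upTo (b Fin.zero)) (λ t → x ^ (c Fin.zero * t)) *ᴿ ∑ (enum r (tail b)) (λ k → x ^ sumℕ (λ j → tail c j * k j))
  ∑-enum-^-linear x r b c = begin
    ∑ (enum (suc r) b) F                                         ≈⟨ ∑-concatMap slice (upTo (b Fin.zero)) F ⟩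
    ∑ (upTo (b Fin.zero)) (λ t → ∑ (slice t) F)                  ≈⟨ ∑-cong (upTo (b Fin.zero)) (λ {t} _ → split t) ⟩
    ∑ (upTo (b Fin.zero)) (λ t → x ^ (c Fin.zero * t) *ᴿ S)      ≈⟨ ∑-*ʳ (upTo (b Fin.zero)) S _ ⟩
    ∑ (upTo (b Fin.zero)) (λ t → x ^ (c Fin.zero * t)) *ᴿ S      ∎
    where
    F : Elt (suc r) → Carrier
    F k = x ^ sumℕ (λ j → c j * k j)
    S : Carrier
    S = ∑ (enum r (tail b)) (λ k → x ^ sumℕ (λ j → tail c j * k j))
    slice : ℕ → List (Elt (suc r))
    slice t = map (t ∷ᵛ_) (enum r (tail b))
    split : ∀ t → ∑ (slice t) F ≈ x ^ (c Fin.zero * t) *ᴿ S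
    split t = begin
      ∑ (slice t) F                  ≡⟨ ∑-map (t ∷ᵛ_) (enum r (tail b)) F ⟩
      ∑ (enum r (tail b)) (F ∘ (t ∷ᵛ_))
        ≈⟨ ∑-cong (enum r (tail b)) (λ {k} _ → trans (^-congʳ x (sumℕ-suc (λ j → c j * (t ∷ᵛ k) j)))
                                                    (^-homo-* x (c Fin.zero * t) _)) ⟩
      ∑ (enum r (tail b)) (λ k → x ^ (c Fin.zero * t) *ᴿ x ^ sumℕ (λ j → tail c j * k j))
        ≈⟨ ∑-*ˡ (enum r (tail b)) _ _ ⟩
      x ^ (c Fin.zero * t) *ᴿ S      ∎

  ∑-enum-^-linear≈0 : ∀ x r (b c : Vector ℕ r) i → ∑ (upTo (b i)) (λ t → x ^ (c i * t)) ≈ 0# →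
    ∑ (enum r b) (λ k → x ^ sumℕ (λ j → c j * k j)) ≈ 0#
  ∑-enum-^-linear≈0 x (suc r) b c Fin.zero    ∑≈0 =
    trans (∑-enum-^-linear x r b c) (trans (*-congʳ ∑≈0) (zeroˡ _))
  ∑-enum-^-linear≈0 x (suc r) b c (Fin.suc i) ∑≈0 =
    trans (∑-enum-^-linear x r b c) (trans (*-congˡ (∑-enum-^-linear≈0 x r (tail b) (tail c) i ∑≈0)) (zeroʳ _))

module GroupProperties (r : ℕ) (m : Vector ℕ r) (nz : ∀ i → NonZero (m i)) where
  open Group r m nz

  private instance
    m≢0 : ∀ {i} → NonZero (m i)
    m≢0 {i} = nz i

  eqG⇒≗ : ∀ {x y} → x <ᵛ m → y <ᵛ m → eqG x y ≡ true → x ≗ y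
  eqG⇒≗ {x} {y} x<m y<m eq i = begin
    x i          ≡⟨ ≡.sym (m<n⇒m%n≡m (x<m i)) ⟩
    x i % m i    ≡⟨ ℕ.≡ᵇ⇒≡ _ _ (All.lookup (All.all⁺ _ (allFin r) (Equivalence.from T-≡ eq))
                                          (∈-allFin i)) ⟩
    y i % m i    ≡⟨ m<n⇒m%n≡m (y<m i) ⟩
    y i          ∎
    where open ≡.≡-Reasoning

  ≗⇒eqG : ∀ {x y} → x ≗ y → eqG x y ≡ true
  ≗⇒eqG x≗y = Equivalence.to T-≡
    (All.all⁻ _ {xs = allFin r} (All.tabulate (λ {i} _ → ℕ.≡⇒≡ᵇ _ _ (≡.cong (_% m i) (x≗y i)))))

  fromList⁻ : ∀ {xs g} → All (_<ᵛ m) xs → g <ᵛ m → fromList xs g ≡ true → ∃ λ x → x ∈ xs × g ≗ x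
  fromList⁻ {xs} {g} xs<m g<m g∈ with any≡true⁻ (eqG g) xs g∈
  ... | x , x∈xs , g≡x = x , x∈xs , eqG⇒≗ g<m (All.lookup xs<m x∈xs) g≡x

  fromList⁺ : ∀ {xs g x} → x ∈ xs → g ≗ x → fromList xs g ≡ true
  fromList⁺ {g = g} x∈xs g≗x =
    Equivalence.to T-≡ (Any.any⁺ (eqG g) (Any.map (λ { ≡.refl → Equivalence.from T-≡ (≗⇒eqG g≗x) }) x∈xs))

  fromList-map⁻ : ∀ {A : Set} (h : A → Elt r) {xs g} → All (λ x → h x <ᵛ m) xs → g <ᵛ m →
    fromList (map h xs) g ≡ true → ∃ λ x → x ∈ xs × g ≗ h x
  fromList-map⁻ h hxs<m g<m g∈ with fromList⁻ (All.map⁺ hxs<m) g<m g∈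
  ... | y , y∈ , g≗y with ∈-map⁻ h y∈
  ... | x , x∈ , ≡.refl = x , x∈ , g≗y

  fromList-map⁺ : ∀ {A : Set} (h : A → Elt r) {xs g x} → x ∈ xs → g ≗ h x → fromList (map h xs) g ≡ true
  fromList-map⁺ h x∈xs = fromList⁺ (∈-map⁺ h x∈xs)

  Canonical : List (Elt r) → Set
  Canonical xs = All (_<ᵛ m) xs × Distinct xs

  module Summation (R : CommutativeRing 0ℓ 0ℓ) where
    open CommutativeRing R renaming (_+_ to _+ᴿ_)
    open ListSum R
    open import Algebra.Definitions.RawSemiring (Algebra.Bundles.Semiring.rawSemiring semiring) using () renaming (_×_ to _·ᴿ_)
    open import Relation.Binary.Reasoning.Setoid setoid

    if-∨ : ∀ a b {c} → (a ≡ true → b ≡ true → ⊥) →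
      (if a ∨ b then c else 0#) ≈ (if a then c else 0#) +ᴿ (if b then c else 0#)
    if-∨ true  true  a∧b = contradiction ≡.refl (a∧b ≡.refl)
    if-∨ true  false _   = sym (+-identityʳ _)
    if-∨ false b     _   = sym (+-identityˡ _)

    sumOver-eqG : ∀ {l} → l <ᵛ m → (f : Elt r → Carrier) → f Preserves _≗_ ⟶ _≈_ →
      sumOver R (λ g → eqG g l) f ≈ f l
    sumOver-eqG {l} l<m f f-cong with ∈-enum⁺ r m l<m
    ... | x , x∈allG , x≗l = trans
      (∑-select allG (λ g → eqG g l) f (enum-distinct r m) x∈allG (≗⇒eqG x≗l)
        (λ g∈allG g≡l → λ i → ≡.trans (eqG⇒≗ (∈-enum⁻ r m g∈allG) l<m g≡l i) (≡.sym (x≗l i))))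
      (f-cong x≗l)

    sumOver-fromList : ∀ {xs} → Canonical xs → (f : Elt r → Carrier) → f Preserves _≗_ ⟶ _≈_ →
      sumOver R (fromList xs) f ≈ ∑ xs f
    sumOver-fromList {[]}     _ f f-cong = ∑-zero allG (λ _ → refl)
    sumOver-fromList {l ∷ xs} (l<m All.∷ xs<m , l≉xs AllPairs.∷ xs-distinct) f f-cong = begin
      ∑ allG (λ g → if eqG g l ∨ fromList xs g then f g else 0#)
        ≈⟨ ∑-cong allG (λ g∈allG → if-∨ _ _ (disjoint g∈allG)) ⟩
      ∑ allG (λ g → (if eqG g l then f g else 0#) +ᴿ (if fromList xs g then f g else 0#))
        ≈⟨ ∑-+ allG _ _ ⟩
      sumOver R (λ g → eqG g l) f +ᴿ sumOver R (fromList xs) f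
        ≈⟨ +-cong (sumOver-eqG l<m f f-cong) (sumOver-fromList (xs<m , xs-distinct) f f-cong) ⟩
      f l +ᴿ ∑ xs f ∎
      where
      disjoint : ∀ {g} → g ∈ allG → eqG g l ≡ true → fromList xs g ≡ true → ⊥
      disjoint g∈allG g≡l g∈xs with fromList⁻ xs<m (∈-enum⁻ r m g∈allG) g∈xs
      ... | x , x∈xs , g≗x = All.lookup l≉xs x∈xs
        (λ i → ≡.trans (≡.sym (eqG⇒≗ (∈-enum⁻ r m g∈allG) l<m g≡l i)) (g≗x i))

    card·1≈sumOver : ∀ X → card X ·ᴿ 1# ≈ sumOver R X (λ _ → 1#)
    card·1≈sumOver X = length-filter≈∑ allG
      where
      length-filter≈∑ : ∀ xs → length (filter (λ x → X x ≟ᵇ true) xs) ·ᴿ 1# ≈ ∑ xs (λ x → if X x then 1# else 0#)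
      length-filter≈∑ []       = refl
      length-filter≈∑ (x ∷ xs) with X x
      ... | true  = +-congˡ (length-filter≈∑ xs)
      ... | false = trans (length-filter≈∑ xs) (sym (+-identityˡ _))

  card-≡ : ∀ X Y → sumOver ℤ-ring X (λ _ → 1ℤ) ≡ sumOver ℤ-ring Y (λ _ → 1ℤ) → card X ≡ card Y
  card-≡ X Y eq = ℤ.+-injective (begin
    ℤ.+ card X                   ≡⟨ n×1≡+n (card X) ⟨
    card X ·ℤ 1ℤ                 ≡⟨ card·1≈sumOver X ⟩
    sumOver ℤ-ring X (λ _ → 1ℤ)  ≡⟨ eq ⟩
    sumOver ℤ-ring Y (λ _ → 1ℤ)  ≡⟨ card·1≈sumOver Y ⟨
    card Y ·ℤ 1ℤ                 ≡⟨ n×1≡+n (card Y) ⟩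
    ℤ.+ card Y                   ∎)
    where
    open ≡.≡-Reasoning
    open Summation ℤ-ring
    open import Algebra.Definitions.RawSemiring ℤ.+-*-rawSemiring using () renaming (_×_ to _·ℤ_)
    n×1≡+n : ∀ n → n ·ℤ 1ℤ ≡ ℤ.+ n
    n×1≡+n zero    = ≡.refl
    n×1≡+n (suc n) = ≡.cong (ℤ._+_ 1ℤ) (n×1≡+n n)

  m∣N : ∀ i → m i ∣ N
  m∣N i = m∣prod (∈-allFin i)
    where
    m∣prod : ∀ {is} → i ∈ is → m i ∣ foldr (λ j acc → m j * acc) 1 is
    m∣prod (here ≡.refl) = ∣m⇒∣m*n _ ∣-refl
    m∣prod (there i∈is)  = ∣n⇒∣m*n (m _) (m∣prod i∈is)

  instance
    N≢0 : NonZero N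
    N≢0 = prod≢0 (allFin r)
      where
      prod≢0 : ∀ is → NonZero (foldr (λ j acc → m j * acc) 1 is)
      prod≢0 []       = _
      prod≢0 (i ∷ is) = ℕ.m*n≢0 (m i) _ ⦃ nz i ⦄ ⦃ prod≢0 is ⦄

  Q : Fin r → ℕ
  Q i = N / m i

  Q*m≡N : ∀ i → Q i * m i ≡ N
  Q*m≡N i = m/n*n≡m (m∣N i)

  δ : Elt r → Elt r → Elt r
  δ l l' i = l i + (m i ∸ l' i)

  δ-diag : ∀ {l l' i} → l' i < m i → l i ≡ l' i → δ l l' i ≡ m i
  δ-diag {l} {l'} {i} l'<m lᵢ≡l'ᵢ = ≡.trans (≡.cong (_+ (m i ∸ l' i)) lᵢ≡l'ᵢ) (ℕ.m+[n∸m]≡n (ℕ.<⇒≤ l'<m))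

  pairExp-cong : ∀ {x y} l l' → x ≗ y → pairExp x l l' ≡ pairExp y l l'
  pairExp-cong l l' x≗y = sumℕ-cong (λ i → ≡.cong (λ xᵢ → Q i * (xᵢ * δ l l' i)) (x≗y i))

  pairExp-+ : ∀ x y l l' → pairExp (x ⊕ᵉ y) l l' ≡ pairExp x l l' + pairExp y l l'
  pairExp-+ x y l l' = ≡.trans (sumℕ-cong (λ i → distrib (Q i) (x i) (y i) (δ l l' i)))
                               (sumℕ-+ (λ i → Q i * (x i * δ l l' i)) (λ i → Q i * (y i * δ l l' i)))
    where
    distrib : ∀ q a b d → q * ((a + b) * d) ≡ q * (a * d) + q * (b * d)
    distrib = solve-∀

  pairExp-single : ∀ x l l' i → (∀ j → j ≢ i → x j ≡ 0) → pairExp x l l' ≡ Q i * (x i * δ l l' i)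
  pairExp-single x l l' i x≡0 = sumℕ-single (λ j → Q j * (x j * δ l l' j)) i
    (λ j j≢i → ≡.trans (≡.cong (λ xⱼ → Q j * (xⱼ * δ l l' j)) (x≡0 j j≢i)) (ℕ.*-zeroʳ (Q j)))

  N∣pairExp : ∀ x {l l'} → l' <ᵛ m → l ≗ l' → N ∣ pairExp x l l'
  N∣pairExp x {l} {l'} l'<m l≗l' = ∣-sumℕ (λ i → Q i * (x i * δ l l' i)) (λ i → divides (x i) (begin
    Q i * (x i * δ l l' i)  ≡⟨ ≡.cong (λ d → Q i * (x i * d)) (δ-diag {l} {l'} (l'<m i) (l≗l' i)) ⟩
    Q i * (x i * m i)       ≡⟨ swap (Q i) (x i) (m i) ⟩
    x i * (Q i * m i)       ≡⟨ ≡.cong (x i *_) (Q*m≡N i) ⟩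
    x i * N                 ∎))
    where
    open ≡.≡-Reasoning
    swap : ∀ q a c → q * (a * c) ≡ a * (q * c)
    swap = solve-∀

  N∣pairExp-unit : ∀ {l l' i} → l' <ᵛ m → l i ≡ l' i → N ∣ pairExp (unit i) l l'
  N∣pairExp-unit {l} {l'} {i} l'<m lᵢ≡l'ᵢ = divides 1 (begin
    pairExp (unit i) l l'        ≡⟨ pairExp-single (unit i) l l' i (λ j j≢i → unit-off (j≢i ∘ ≡.sym)) ⟩
    Q i * (unit i i * δ l l' i)  ≡⟨ ≡.cong₂ (λ e d → Q i * (e * d)) (unit-diag i) (δ-diag {l} {l'} (l'<m i) lᵢ≡l'ᵢ) ⟩
    Q i * (1 * m i)              ≡⟨ ≡.cong (Q i *_) (ℕ.*-identityˡ (m i)) ⟩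
    Q i * m i                    ≡⟨ Q*m≡N i ⟩
    N                            ≡⟨ ℕ.*-identityˡ N ⟨
    1 * N                        ∎)
    where open ≡.≡-Reasoning

  module Characters (R : CommutativeRing 0ℓ 0ℓ) (integral : IntegralDomain R)
                    (ζ : CommutativeRing.Carrier R) (prim : PrimitiveRoot R ζ) where
    open CommutativeRing R renaming (_+_ to _+ᴿ_; _*_ to _*ᴿ_)
    open ListSum R
    open Summation R
    open Powers R
    open import Algebra.Definitions.RawSemiring (Algebra.Bundles.Semiring.rawSemiring semiring)
      using (_^_) renaming (_×_ to _·ᴿ_)
    open import Algebra.Properties.Semiring.Exp semiring using (^-homo-*; ^-assocʳ; ^-congʳ)
    open import Relation.Binary.Reasoning.Setoid setoid

    χ : Elt r → Elt r → Elt r → Carrier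
    χ l l' x = ζ ^ pairExp x l l'

    χ-cong : ∀ l l' → χ l l' Preserves _≗_ ⟶ _≈_
    χ-cong l l' x≗y = ^-congʳ ζ (pairExp-cong l l' x≗y)

    χ-+ : ∀ l l' x y → χ l l' (x ⊕ᵉ y) ≈ χ l l' x *ᴿ χ l l' y
    χ-+ l l' x y = trans (^-congʳ ζ (pairExp-+ x y l l')) (^-homo-* ζ (pairExp x l l') (pairExp y l l'))

    ζ^-∣ : ∀ {e} → N ∣ e → ζ ^ e ≈ 1#
    ζ^-∣ = ∣⇒^≈1 ζ N (proj₁ prim) (proj₂ prim)

    orthogonal⁺ : ∀ X Λ →
      (∀ {l l'} → l <ᵛ m → l' <ᵛ m → Λ l ≡ true → Λ l' ≡ true → ¬ l ≗ l' → sumOver R X (χ l l') ≈ 0#) →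
      Orthogonal R ζ X Λ
    orthogonal⁺ X Λ off-diagonal l l' l<m l'<m l∈Λ l'∈Λ with eqG l l' in l≡l'
    ... | true  = begin
      sumOver R X (χ l l')
        ≈⟨ ∑-cong allG (λ {x} _ → if-cong (X x) (ζ^-∣ (N∣pairExp x l'<m (eqG⇒≗ l<m l'<m l≡l')))) ⟩
      sumOver R X (λ _ → 1#)  ≈⟨ card·1≈sumOver X ⟨
      card X ·ᴿ 1#            ∎
      where
      if-cong : ∀ b {x y} → x ≈ y → (if b then x else 0#) ≈ (if b then y else 0#)
      if-cong true  x≈y = x≈y
      if-cong false _   = refl
    ... | false = off-diagonal l<m l'<m l∈Λ l'∈Λ (λ l≗l' → contradiction (≡.trans (≡.sym l≡l') (≗⇒eqG l≗l')) λ ())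

    ∑-character≈0 : ∀ i {n a d} → a * n ≡ m i → ¬ n ∣ d → ∑ (upTo n) (λ t → ζ ^ (Q i * (a * d) * t)) ≈ 0#
    ∑-character≈0 i {n} {a} {d} an≡m n∤d = begin
      ∑ (upTo n) (λ t → ζ ^ (c * t))  ≈⟨ ∑-cong (upTo n) (λ {t} _ → sym (^-assocʳ ζ c t)) ⟩
      ∑ (upTo n) (ω ^_)               ≈⟨ geometric-sum≈0 integral ω n ωⁿ≈1 ω≉1 ⟩
      0#                              ∎
      where
      c = Q i * (a * d)
      ω = ζ ^ c
      cn≡dN : c * n ≡ d * N
      cn≡dN = ≡.trans (shuffle (Q i) a d n) (≡.trans (≡.cong (λ k → d * (Q i * k)) an≡m) (≡.cong (d *_) (Q*m≡N i)))
        where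
        shuffle : ∀ q a d n → q * (a * d) * n ≡ d * (q * (a * n))
        shuffle = solve-∀
      ωⁿ≈1 : ω ^ n ≈ 1#
      ωⁿ≈1 = trans (^-assocʳ ζ c n) (ζ^-∣ (divides d cn≡dN))
      ω≉1 : ¬ ω ≈ 1#
      ω≉1 ω≈1 = n∤d (*-cancelˡ-∣ a ⦃ a≢0 ⦄ (*-cancelˡ-∣ (Q i) ⦃ Q≢0 ⦄ (≡.subst (_∣ c) N≡Qan N∣c)))
        where
        N∣c : N ∣ c
        N∣c = ^≈1⇒∣ ζ N (proj₁ prim) (proj₂ prim) ω≈1
        N≡Qan : N ≡ Q i * (a * n)
        N≡Qan = ≡.sym (≡.trans (≡.cong (Q i *_) an≡m) (Q*m≡N i))
        a≢0 : NonZero a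
        a≢0 = ℕ.m*n≢0⇒m≢0 a ⦃ ≡.subst NonZero (≡.sym an≡m) (nz i) ⦄
        Q≢0 : NonZero (Q i)
        Q≢0 = ℕ.m*n≢0⇒m≢0 (Q i) ⦃ ≡.subst NonZero (≡.sym (Q*m≡N i)) N≢0 ⦄

    ∑-enum-character≈0 : ∀ b (a d : Vector ℕ r) i → a i * b i ≡ m i → ¬ b i ∣ d i →
      ∑ (enum r b) (λ k → ζ ^ sumℕ (λ j → Q j * (a j * d j) * k j)) ≈ 0#
    ∑-enum-character≈0 b a d i ab≡m b∤d =
      ∑-enum-^-linear≈0 ζ r b (λ j → Q j * (a j * d j)) i (∑-character≈0 i {a = a i} ab≡m b∤d)

module ProductSets (r : ℕ) (u v : Vector ℕ r) (hu : ∀ i → 1 < u i) (hv : ∀ i → 1 < v i)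
                   (π : Permutation′ r) where
  open Sets r u v π (nzProd u v hu hv)
  open GroupProperties r m (nzProd u v hu hv)

  private instance
    u≢0 : ∀ {i} → NonZero (u i)
    u≢0 {i} = >-nonZero (ℕ.<-trans (s≤s z≤n) (hu i))
    v≢0 : ∀ {i} → NonZero (v i)
    v≢0 {i} = >-nonZero (ℕ.<-trans (s≤s z≤n) (hv i))

  <u⇒<m : ∀ {k} → k <ᵛ u → k <ᵛ m
  <u⇒<m k<u i = ℕ.<-≤-trans (k<u i) (ℕ.m≤m*n (u i) (v i))

  <v⇒<m : ∀ {k} → k <ᵛ v → k <ᵛ m
  <v⇒<m k<v i = ℕ.<-≤-trans (k<v i) (ℕ.m≤n*m (v i) (u i))

  <u⇒v·<m : ∀ {k} → k <ᵛ u → v ·ᵛ k <ᵛ m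
  <u⇒v·<m {k} k<u i = ≡.subst (v i * k i <_) (ℕ.*-comm (v i) (u i)) (ℕ.*-monoʳ-< (v i) (k<u i))

  <v⇒u·<m : ∀ {k} → k <ᵛ v → u ·ᵛ k <ᵛ m
  <v⇒u·<m k<v i = ℕ.*-monoʳ-< (u i) (k<v i)

  ·ᵛ-cancel : ∀ (a : Vector ℕ r) → (∀ i → NonZero (a i)) → ∀ {x y} → a ·ᵛ x ≗ a ·ᵛ y → x ≗ y
  ·ᵛ-cancel a a≢0 ax≗ay i = ℕ.*-cancelˡ-≡ _ _ (a i) ⦃ a≢0 i ⦄ (ax≗ay i)

  canonical-enum : ∀ {b} → (∀ {k} → k <ᵛ b → k <ᵛ m) → Canonical (enum r b)
  canonical-enum {b} <b⇒<m = All.tabulate (<b⇒<m ∘ ∈-enum⁻ r b) , enum-distinct r b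

  canonical-scaled-enum : ∀ {a b} → (∀ i → NonZero (a i)) → (∀ {k} → k <ᵛ b → a ·ᵛ k <ᵛ m) →
    Canonical (map (a ·ᵛ_) (enum r b))
  canonical-scaled-enum {a} {b} a≢0 <b⇒<m =
    All.map⁺ (All.tabulate (<b⇒<m ∘ ∈-enum⁻ r b)) ,
    AllPairs.map⁺ (AllPairs.map (λ x≉y → x≉y ∘ ·ᵛ-cancel a a≢0) (enum-distinct r b))

  ΛA⁻ : ∀ {l} → l <ᵛ m → ΛA l ≡ true → ∃ λ j → j <ᵛ u × l ≗ v ·ᵛ j
  ΛA⁻ l<m l∈ΛA with fromList-map⁻ (v ·ᵛ_) (All.tabulate (<u⇒v·<m ∘ ∈-enum⁻ r u)) l<m l∈ΛA
  ... | j , j∈ , l≗vj = j , ∈-enum⁻ r u j∈ , l≗vj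

  ΛB⁻ : ∀ {l} → l <ᵛ m → ΛB l ≡ true → l <ᵛ v
  ΛB⁻ l<m l∈ΛB with fromList⁻ (All.tabulate (<v⇒<m ∘ ∈-enum⁻ r v)) l<m l∈ΛB
  ... | x , x∈ , l≗x = λ i → ≡.subst (_< v i) (≡.sym (l≗x i)) (∈-enum⁻ r v x∈ i)

  B′⁻ : ∀ {g} → g <ᵛ m → B′ g ≡ true → ∃ λ k → k <ᵛ v × g ≗ u ·ᵛ k
  B′⁻ g<m g∈B′ with fromList-map⁻ (u ·ᵛ_) (All.tabulate (<v⇒u·<m ∘ ∈-enum⁻ r v)) g<m g∈B′
  ... | k , k∈ , g≗uk = k , ∈-enum⁻ r v k∈ , g≗uk

  B′⁺ : ∀ {g k} → k <ᵛ v → g ≗ u ·ᵛ k → B′ g ≡ true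
  B′⁺ k<v g≗uk with ∈-enum⁺ r v k<v
  ... | x , x∈ , x≗k = fromList-map⁺ (u ·ᵛ_) x∈ (λ i → ≡.trans (g≗uk i) (≡.cong (u i *_) (≡.sym (x≗k i))))

  δ-scaled : ∀ {l l' j j'} i → l ≗ v ·ᵛ j → l' ≗ v ·ᵛ j' → δ l l' i ≡ v i * (j i + (u i ∸ j' i))
  δ-scaled {l} {l'} {j} {j'} i l≗vj l'≗vj' = begin
    l i + (u i * v i ∸ l' i)                 ≡⟨ ≡.cong₂ (λ a b → a + (u i * v i ∸ b)) (l≗vj i) (l'≗vj' i) ⟩
    v i * j i + (u i * v i ∸ v i * j' i)     ≡⟨ ≡.cong (λ c → v i * j i + (c ∸ v i * j' i)) (ℕ.*-comm (u i) (v i)) ⟩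
    v i * j i + (v i * u i ∸ v i * j' i)     ≡⟨ ≡.cong (v i * j i +_) (≡.sym (ℕ.*-distribˡ-∸ (v i) (u i) (j' i))) ⟩
    v i * j i + v i * (u i ∸ j' i)           ≡⟨ ≡.sym (ℕ.*-distribˡ-+ (v i) (j i) _) ⟩
    v i * (j i + (u i ∸ j' i))               ∎
    where open ≡.≡-Reasoning

  v∤δ : ∀ {l l'} i → l <ᵛ v → l' <ᵛ v → l i ≢ l' i → ¬ v i ∣ δ l l' i
  v∤δ i l<v l'<v lᵢ≢l'ᵢ =
    x≢y⇒∤x+[c∸y] (l<v i) (l'<v i) lᵢ≢l'ᵢ (divides (u i) ≡.refl) (ℕ.<⇒≤ (<v⇒<m l'<v i))

  module Orthogonality (R : CommutativeRing 0ℓ 0ℓ) (integral : IntegralDomain R)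
                       (ζ : CommutativeRing.Carrier R) (prim : PrimitiveRoot R ζ) where
    open CommutativeRing R renaming (_+_ to _+ᴿ_; _*_ to _*ᴿ_)
    open ListSum R
    open Summation R
    open Characters R integral ζ prim
    open import Algebra.Definitions.RawSemiring (Algebra.Bundles.Semiring.rawSemiring semiring) using (_^_)
    open import Algebra.Properties.Semiring.Exp semiring using (^-congʳ)
    open import Relation.Binary.Reasoning.Setoid setoid

    A-orthogonal : Orthogonal R ζ A ΛA
    A-orthogonal = orthogonal⁺ A ΛA off-diagonal
      where
      off-diagonal : ∀ {l l'} → l <ᵛ m → l' <ᵛ m → ΛA l ≡ true → ΛA l' ≡ true → ¬ l ≗ l' →
                     sumOver R A (χ l l') ≈ 0#
      off-diagonal {l} {l'} l<m l'<m l∈ l'∈ l≉l' with ΛA⁻ l<m l∈ | ΛA⁻ l'<m l'∈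
      ... | j , j<u , l≗vj | j' , j'<u , l'≗vj'
        with ¬∀⟶∃¬ r (λ i → j i ≡ j' i) (λ i → j i ℕ.≟ j' i)
               (λ j≗j' → l≉l' (λ i → ≡.trans (l≗vj i) (≡.trans (≡.cong (v i *_) (j≗j' i)) (≡.sym (l'≗vj' i)))))
      ... | i , jᵢ≢j'ᵢ = begin
        sumOver R A (χ l l')
          ≈⟨ sumOver-fromList (canonical-enum <u⇒<m) (χ l l') (χ-cong l l') ⟩
        ∑ (enum r u) (χ l l')
          ≈⟨ ∑-cong (enum r u) (λ {k} _ → ^-congʳ ζ (sumℕ-cong (exponent k))) ⟩
        ∑ (enum r u) (λ k → ζ ^ sumℕ (λ i → Q i * (v i * e i) * k i))
          ≈⟨ ∑-enum-character≈0 u v e i (ℕ.*-comm (v i) (u i))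
               (x≢y⇒∤x+[c∸y] (j<u i) (j'<u i) jᵢ≢j'ᵢ (divides 1 (≡.sym (ℕ.*-identityˡ (u i))))
                             (ℕ.<⇒≤ (j'<u i))) ⟩
        0# ∎
        where
        e : Vector ℕ r
        e i = j i + (u i ∸ j' i)
        exponent : ∀ k i → Q i * (k i * δ l l' i) ≡ Q i * (v i * e i) * k i
        exponent k i = ≡.trans (≡.cong (λ d → Q i * (k i * d)) (δ-scaled i l≗vj l'≗vj')) (shuffle (Q i) (k i) (v i * e i))
          where
          shuffle : ∀ q k c → q * (k * c) ≡ q * c * k
          shuffle = solve-∀

    sumOver-B′-χ≈0 : ∀ {l l'} → l <ᵛ v → l' <ᵛ v → ¬ l ≗ l' → sumOver R B′ (χ l l') ≈ 0#
    sumOver-B′-χ≈0 {l} {l'} l<v l'<v l≉l' with ¬∀⟶∃¬ r (λ i → l i ≡ l' i) (λ i → l i ℕ.≟ l' i) l≉l'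
    ... | i , lᵢ≢l'ᵢ = begin
      sumOver R B′ (χ l l')
        ≈⟨ sumOver-fromList (canonical-scaled-enum (λ _ → u≢0) <v⇒u·<m) (χ l l') (χ-cong l l') ⟩
      ∑ (map (u ·ᵛ_) (enum r v)) (χ l l')
        ≡⟨ ∑-map (u ·ᵛ_) (enum r v) (χ l l') ⟩
      ∑ (enum r v) (χ l l' ∘ (u ·ᵛ_))
        ≈⟨ ∑-cong (enum r v) (λ {k} _ → ^-congʳ ζ (sumℕ-cong (λ i → shuffle (Q i) (u i) (k i) (δ l l' i)))) ⟩
      ∑ (enum r v) (λ k → ζ ^ sumℕ (λ i → Q i * (u i * δ l l' i) * k i))
        ≈⟨ ∑-enum-character≈0 v u (δ l l') i ≡.refl (v∤δ i l<v l'<v lᵢ≢l'ᵢ) ⟩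
      0# ∎
      where
      shuffle : ∀ q a k d → q * ((a * k) * d) ≡ q * (a * d) * k
      shuffle = solve-∀

    B′-orthogonal : Orthogonal R ζ B′ ΛB
    B′-orthogonal = orthogonal⁺ B′ ΛB (λ l<m l'<m l∈ l'∈ → sumOver-B′-χ≈0 (ΛB⁻ l<m l∈) (ΛB⁻ l'<m l'∈))

  private
    one : Elt r → ℤ
    one _ = 1ℤ

    one-cong : one Preserves _≗_ ⟶ _≡_
    one-cong _ = ≡.refl

  card-ΛA≡card-A : card ΛA ≡ card A
  card-ΛA≡card-A = card-≡ ΛA A (begin
    sumOver ℤ-ring ΛA one           ≡⟨ sumOver-fromList (canonical-scaled-enum (λ _ → v≢0) <u⇒v·<m) one one-cong ⟩
    ∑ (map (v ·ᵛ_) (enum r u)) one  ≡⟨ ∑-map (v ·ᵛ_) (enum r u) one ⟩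
    ∑ (enum r u) one                ≡⟨ sumOver-fromList (canonical-enum <u⇒<m) one one-cong ⟨
    sumOver ℤ-ring A one            ∎)
    where
    open ≡.≡-Reasoning
    open ListSum ℤ-ring
    open Summation ℤ-ring

  card-ΛB≡card-B′ : card ΛB ≡ card B′
  card-ΛB≡card-B′ = card-≡ ΛB B′ (begin
    sumOver ℤ-ring ΛB one           ≡⟨ sumOver-fromList (canonical-enum <v⇒<m) one one-cong ⟩
    ∑ (enum r v) one                ≡⟨ ∑-map (u ·ᵛ_) (enum r v) one ⟨
    ∑ (map (u ·ᵛ_) (enum r v)) one  ≡⟨ sumOver-fromList (canonical-scaled-enum (λ _ → u≢0) <v⇒u·<m) one one-cong ⟨
    sumOver ℤ-ring B′ one           ∎)
    where
    open ≡.≡-Reasoning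
    open ListSum ℤ-ring
    open Summation ℤ-ring

  ΛA⁺ : ∀ {x j} → j <ᵛ u → x ≗ v ·ᵛ j → ΛA x ≡ true
  ΛA⁺ j<u x≗vj with ∈-enum⁺ r u j<u
  ... | j′ , j′∈ , j′≗j =
    fromList-map⁺ (v ·ᵛ_) j′∈ (λ i → ≡.trans (x≗vj i) (≡.cong (v i *_) (≡.sym (j′≗j i))))

  ΛB⁺ : ∀ {y} → y <ᵛ v → ΛB y ≡ true
  ΛB⁺ y<v with ∈-enum⁺ r v y<v
  ... | y′ , y′∈ , y′≗y = fromList⁺ y′∈ (λ i → ≡.sym (y′≗y i))

  v·j+y<m : ∀ {j y} → j <ᵛ u → y <ᵛ v → (v ·ᵛ j) ⊕ᵉ y <ᵛ m
  v·j+y<m {j} {y} j<u y<v i = begin-strict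
    v i * j i + y i     <⟨ ℕ.+-monoʳ-< (v i * j i) (y<v i) ⟩
    v i * j i + v i     ≡⟨ ℕ.+-comm (v i * j i) (v i) ⟩
    v i + v i * j i     ≡⟨ ℕ.*-suc (v i) (j i) ⟨
    v i * suc (j i)     ≤⟨ ℕ.*-monoʳ-≤ (v i) (j<u i) ⟩
    v i * u i           ≡⟨ ℕ.*-comm (v i) (u i) ⟩
    u i * v i           ∎
    where open ℕ.≤-Reasoning

  ΛA⊕ΛB≡G : DirectSumIsG ΛA ΛB
  ΛA⊕ΛB≡G = decompose , decomposition-unique
    where
    decompose : ∀ g → g <ᵛ m → ∃ λ x → ∃ λ y →
      x <ᵛ m × y <ᵛ m × ΛA x ≡ true × ΛB y ≡ true × eqG (x ⊕ᵉ y) g ≡ true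
    decompose g g<m = v ·ᵛ q , ρ , <u⇒v·<m q<u , <v⇒<m ρ<v , ΛA⁺ q<u (λ _ → ≡.refl) , ΛB⁺ ρ<v , ≗⇒eqG division
      where
      q ρ : Elt r
      q i = g i / v i
      ρ i = g i % v i
      q<u : q <ᵛ u
      q<u i = m<n*o⇒m/o<n (g<m i)
      ρ<v : ρ <ᵛ v
      ρ<v i = m%n<n (g i) (v i)
      division : (v ·ᵛ q) ⊕ᵉ ρ ≗ g
      division i = begin
        v i * q i + ρ i  ≡⟨ ℕ.+-comm (v i * q i) (ρ i) ⟩
        ρ i + v i * q i  ≡⟨ ≡.cong (ρ i +_) (ℕ.*-comm (v i) (q i)) ⟩
        ρ i + q i * v i  ≡⟨ m≡m%n+[m/n]*n (g i) (v i) ⟨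
        g i              ∎
        where open ≡.≡-Reasoning
    decomposition-unique : ∀ x y x' y' → x <ᵛ m → y <ᵛ m → x' <ᵛ m → y' <ᵛ m →
      ΛA x ≡ true → ΛB y ≡ true → ΛA x' ≡ true → ΛB y' ≡ true →
      eqG (x ⊕ᵉ y) (x' ⊕ᵉ y') ≡ true → eqG x x' ≡ true × eqG y y' ≡ true
    decomposition-unique x y x' y' x<m y<m x'<m y'<m x∈ y∈ x'∈ y'∈ sum≡ with ΛA⁻ x<m x∈ | ΛA⁻ x'<m x'∈
    ... | j , j<u , x≗vj | j' , j'<u , x'≗vj' = ≗⇒eqG x≗x' , ≗⇒eqG y≗y'
      where
      y<v = ΛB⁻ y<m y∈
      y'<v = ΛB⁻ y'<m y'∈
      vj+y<m : ∀ {x y j} → j <ᵛ u → x ≗ v ·ᵛ j → y <ᵛ v → x ⊕ᵉ y <ᵛ m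
      vj+y<m j<u x≗vj y<v i = ≡.subst (λ a → a + _ < m i) (≡.sym (x≗vj i)) (v·j+y<m j<u y<v i)
      x+y≗x'+y' : x ⊕ᵉ y ≗ x' ⊕ᵉ y'
      x+y≗x'+y' = eqG⇒≗ (vj+y<m j<u x≗vj y<v) (vj+y<m j'<u x'≗vj' y'<v) sum≡
      y≗y' : y ≗ y'
      y≗y' i = residue-unique (j i) (j' i) (y<v i) (y'<v i) (begin
        y i + j i * v i      ≡⟨ ≡.cong (y i +_) (ℕ.*-comm (j i) (v i)) ⟩
        y i + v i * j i      ≡⟨ ≡.cong (y i +_) (≡.sym (x≗vj i)) ⟩
        y i + x i            ≡⟨ ℕ.+-comm (y i) (x i) ⟩
        x i + y i            ≡⟨ x+y≗x'+y' i ⟩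
        x' i + y' i          ≡⟨ ℕ.+-comm (x' i) (y' i) ⟩
        y' i + x' i          ≡⟨ ≡.cong (y' i +_) (x'≗vj' i) ⟩
        y' i + v i * j' i    ≡⟨ ≡.cong (y' i +_) (ℕ.*-comm (v i) (j' i)) ⟩
        y' i + j' i * v i    ∎)
        where open ≡.≡-Reasoning
      x≗x' : x ≗ x'
      x≗x' i = ℕ.+-cancelʳ-≡ (y i) (x i) (x' i) (≡.trans (x+y≗x'+y' i) (≡.cong (x' i +_) (≡.sym (y≗y' i))))

module ShiftedSet (r : ℕ) (u v : Vector ℕ r) (hu : ∀ i → 1 < u i) (hv : ∀ i → 1 < v i)
                  (π : Permutation′ r) (no-short-cycles : NoShortCycles π) where
  open Sets r u v π (nzProd u v hu hv)
  open GroupProperties r m (nzProd u v hu hv)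
  open ProductSets r u v hu hv π

  private instance
    u≢0 : ∀ {i} → NonZero (u i)
    u≢0 {i} = >-nonZero (ℕ.<-trans (s≤s z≤n) (hu i))

  p : Fin r → Fin r
  p i = π ⟨$⟩ʳ i

  p-injective : ∀ {i j} → p i ≡ p j → i ≡ j
  p-injective {i} {j} pi≡pj = ≡.trans (≡.sym (inverseˡ π)) (≡.trans (≡.cong (π ⟨$⟩ˡ_) pi≡pj) (inverseˡ π))

  β : Vector ℕ r → Fin r → ℕ → Elt r
  β w i k = ((k * w i) ·ᵉ unit i) ⊕ᵉ (w (p i) ·ᵉ unit (p i))

  pi≢i : ∀ i → p i ≢ i
  pi≢i i = proj₁ (no-short-cycles i)

  β-at-i : ∀ w i k → β w i k i ≡ k * w i
  β-at-i w i k = ≡.trans (≡.cong₂ (λ a b → k * w i * a + w (p i) * b) (unit-diag i) (unit-off (pi≢i i)))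
                         (simplify (k * w i) (w (p i)))
    where
    simplify : ∀ a b → a * 1 + b * 0 ≡ a
    simplify = solve-∀

  β-at-pi : ∀ w i k → β w i k (p i) ≡ w (p i)
  β-at-pi w i k = ≡.trans (≡.cong₂ (λ a b → k * w i * a + w (p i) * b) (unit-off (pi≢i i ∘ ≡.sym)) (unit-diag (p i)))
                          (simplify (k * w i) (w (p i)))
    where
    simplify : ∀ a b → a * 0 + b * 1 ≡ b
    simplify = solve-∀

  β-elsewhere : ∀ w i k {j} → i ≢ j → p i ≢ j → β w i k j ≡ 0
  β-elsewhere w i k i≢j pi≢j = ≡.trans (≡.cong₂ (λ a b → k * w i * a + w (p i) * b) (unit-off i≢j) (unit-off pi≢j))
                                       (simplify (k * w i) (w (p i)))
    where
    simplify : ∀ a b → a * 0 + b * 0 ≡ 0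
    simplify = solve-∀

  β-scale : ∀ w i k → β w i k ≗ w ·ᵛ β (λ _ → 1) i k
  β-scale w i k j = begin
    k * w i * unit i j + w (p i) * unit (p i) j    ≡⟨ ≡.cong (_+ w (p i) * unit (p i) j) (ℕ.*-assoc k (w i) _) ⟩
    k * (w i * unit i j) + w (p i) * unit (p i) j  ≡⟨ ≡.cong₂ (λ a b → k * a + b) (unit-scale w i j) (unit-scale w (p i) j) ⟨
    k * (w j * unit i j) + w j * unit (p i) j      ≡⟨ shuffle k (w j) (unit i j) (unit (p i) j) ⟩
    w j * (k * 1 * unit i j + 1 * unit (p i) j)    ∎
    where
    open ≡.≡-Reasoning
    shuffle : ∀ k w a b → k * (w * a) + w * b ≡ w * (k * 1 * a + 1 * b)
    shuffle = solve-∀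

  β⊕g-at-i : ∀ i k → (β u i k ⊕ᵉ unit i) i ≡ 1 + k * u i
  β⊕g-at-i i k = ≡.trans (≡.cong₂ _+_ (β-at-i u i k) (unit-diag i)) (ℕ.+-comm (k * u i) 1)

  β-support : ∀ i k {j} → β u i k j ≢ 0 → i ≡ j ⊎ p i ≡ j
  β-support i k {j} βj≢0 = cases (i ≟ j) (p i ≟ j)
    where
    cases : Dec (i ≡ j) → Dec (p i ≡ j) → i ≡ j ⊎ p i ≡ j
    cases (yes i≡j) _          = inj₁ i≡j
    cases (no _)    (yes pi≡j) = inj₂ pi≡j
    cases (no i≢j)  (no pi≢j)  = contradiction (β-elsewhere u i k i≢j pi≢j) βj≢0

  β-injective : ∀ i {s t} → β u i s ≗ β u i t → s ≡ t
  β-injective i {s} {t} βs≗βt =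
    ℕ.*-cancelʳ-≡ s t (u i) (≡.trans (≡.sym (β-at-i u i s)) (≡.trans (βs≗βt i) (β-at-i u i t)))

  β-bounded : ∀ w (b : Vector ℕ r) i {k} → k * w i < b i → w (p i) < b (p i) → (∀ j → 0 < b j) → β w i k <ᵛ b
  β-bounded w b i {k} kw<b w<b b>0 j = cases (i ≟ j) (p i ≟ j)
    where
    cases : Dec (i ≡ j) → Dec (p i ≡ j) → β w i k j < b j
    cases (yes ≡.refl) _            = ≡.subst (_< b i) (≡.sym (β-at-i w i k)) kw<b
    cases (no _)       (yes ≡.refl) = ≡.subst (_< b (p i)) (≡.sym (β-at-pi w i k)) w<b
    cases (no i≢j)     (no pi≢j)    = ≡.subst (_< b j) (≡.sym (β-elsewhere w i k i≢j pi≢j)) (b>0 j)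

  β<m : ∀ i {k} → k < v i → β u i k <ᵛ m
  β<m i {k} k<v = β-bounded u m i {k}
    (≡.subst (k * u i <_) (ℕ.*-comm (v i) (u i)) (ℕ.*-monoˡ-< (u i) k<v))
    (ℕ.m<m*n (u (p i)) (v (p i)) (hv (p i)))
    (λ j → ℕ.>-nonZero⁻¹ (m j) ⦃ nzProd u v hu hv j ⦄)

  β⊕g<m : ∀ i {k} → k < v i → β u i k ⊕ᵉ unit i <ᵛ m
  β⊕g<m i {k} k<v j = cases (i ≟ j)
    where
    cases : Dec (i ≡ j) → (β u i k ⊕ᵉ unit i) j < m j
    cases (yes ≡.refl) = ≡.subst (_< m i) (≡.sym (β⊕g-at-i i k)) (ℕ.<-≤-trans (ℕ.+-monoˡ-< (k * u i) (hu i))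
                           (≡.subst (suc k * u i ≤_) (ℕ.*-comm (v i) (u i)) (ℕ.*-monoˡ-≤ (u i) k<v)))
    cases (no i≢j)     = ≡.subst (_< m j) (≡.sym (≡.trans (≡.cong (β u i k j +_) (unit-off i≢j)) (ℕ.+-identityʳ _)))
                           (β<m i k<v j)

  Bᵢ-canonical : ∀ i → Canonical (Blist i)
  Bᵢ-canonical i =
    All.map⁺ (All.tabulate (β<m i ∘ ∈-upTo⁻)) ,
    AllPairs.map⁺ (AllPairs.map (λ s≢t → s≢t ∘ β-injective i) (upTo⁺ (v i)))

  Bᵢ+gᵢ-canonical : ∀ i → Canonical (map (_⊕ᵉ unit i) (Blist i))
  Bᵢ+gᵢ-canonical i =
    All.map⁺ (All.map⁺ (All.tabulate (β⊕g<m i ∘ ∈-upTo⁻))) ,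
    AllPairs.map⁺ (AllPairs.map (λ x≉y x⊕g≗y⊕g → x≉y (λ j → ℕ.+-cancelʳ-≡ (unit i j) _ _ (x⊕g≗y⊕g j)))
                                (proj₂ (Bᵢ-canonical i)))

  Bᵢ⁻ : ∀ i {g} → g <ᵛ m → Bi i g ≡ true → ∃ λ k → k < v i × g ≗ β u i k
  Bᵢ⁻ i g<m g∈Bᵢ with fromList-map⁻ (β u i) (All.tabulate (β<m i ∘ ∈-upTo⁻)) g<m g∈Bᵢ
  ... | k , k∈ , g≗β = k , ∈-upTo⁻ k∈ , g≗β

  Bᵢ+gᵢ⁻ : ∀ i {g} → g <ᵛ m → Bi+gi i g ≡ true → ∃ λ k → k < v i × g ≗ β u i k ⊕ᵉ unit i
  Bᵢ+gᵢ⁻ i g<m g∈ with fromList-map⁻ (_⊕ᵉ unit i) (All.map⁺ (All.tabulate (β⊕g<m i ∘ ∈-upTo⁻))) g<m g∈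
  ... | x , x∈ , g≗x⊕g with ∈-map⁻ (β u i) x∈
  ... | k , k∈ , ≡.refl = k , ∈-upTo⁻ k∈ , g≗x⊕g

  Bᵢ⊆B′ : ∀ i {g} → g <ᵛ m → Bi i g ≡ true → B′ g ≡ true
  Bᵢ⊆B′ i g<m g∈Bᵢ with Bᵢ⁻ i g<m g∈Bᵢ
  ... | k , k<v , g≗β = B′⁺ K<v (λ j → ≡.trans (g≗β j) (β-scale u i k j))
    where
    K<v : β (λ _ → 1) i k <ᵛ v
    K<v = β-bounded (λ _ → 1) v i {k} (≡.subst (_< v i) (≡.sym (ℕ.*-identityʳ k)) k<v) (hv (p i))
                    (λ j → ℕ.<-trans (s≤s z≤n) (hv j))

  -- A common element forces π i ∈ {j, π j} and π j ∈ {i, π i}; for i ≠ j this is a 2-cycle.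
  Bᵢ-disjoint : ∀ {i j g} → g <ᵛ m → Bi i g ≡ true → Bi j g ≡ true → i ≡ j
  Bᵢ-disjoint {i} {j} g<m g∈Bᵢ g∈Bⱼ with Bᵢ⁻ i g<m g∈Bᵢ | Bᵢ⁻ j g<m g∈Bⱼ
  ... | k , _ , g≗βᵢ | l , _ , g≗βⱼ =
    combine (β-support j l (nonzero-at-p i k βᵢ≗βⱼ)) (β-support i k (nonzero-at-p j l (≡.sym ∘ βᵢ≗βⱼ)))
    where
    βᵢ≗βⱼ : β u i k ≗ β u j l
    βᵢ≗βⱼ t = ≡.trans (≡.sym (g≗βᵢ t)) (g≗βⱼ t)
    nonzero-at-p : ∀ i' k' {x} → β u i' k' ≗ x → x (p i') ≢ 0
    nonzero-at-p i' k' β≗x x≡0 =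
      ℕ.≢-nonZero⁻¹ (u (p i')) (≡.trans (≡.sym (β-at-pi u i' k')) (≡.trans (β≗x (p i')) x≡0))
    combine : j ≡ p i ⊎ p j ≡ p i → i ≡ p j ⊎ p i ≡ p j → i ≡ j
    combine _            (inj₂ pi≡pj) = p-injective pi≡pj
    combine (inj₂ pj≡pi) _            = p-injective (≡.sym pj≡pi)
    combine (inj₁ j≡pi)  (inj₁ i≡pj)  =
      contradiction (≡.trans (≡.cong p (≡.sym j≡pi)) (≡.sym i≡pj)) (proj₂ (no-short-cycles i))

  -- Coordinate i is 1 mod uᵢ on Bᵢ + gᵢ and 0 mod uᵢ on B′.
  Bᵢ+gᵢ∩B′ : ∀ i {g} → g <ᵛ m → Bi+gi i g ≡ true → B′ g ≡ false
  Bᵢ+gᵢ∩B′ i {g} g<m g∈ with B′ g in g∈B′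
  ... | false = ≡.refl
  ... | true with B′⁻ g<m g∈B′ | Bᵢ+gᵢ⁻ i g<m g∈
  ...   | K , _ , g≗uK | k , _ , g≗β⊕g = contradiction
          (residue-unique {u i} (K i) k (ℕ.>-nonZero⁻¹ (u i)) (hu i) (begin
            0 + K i * u i   ≡⟨ ℕ.*-comm (K i) (u i) ⟩
            u i * K i       ≡⟨ ≡.sym (g≗uK i) ⟩
            g i             ≡⟨ g≗β⊕g i ⟩
            (β u i k ⊕ᵉ unit i) i ≡⟨ β⊕g-at-i i k ⟩
            1 + k * u i     ∎))
          λ ()
    where open ≡.≡-Reasoning

  Bᵢ+gᵢ-disjoint : ∀ {i j g} → g <ᵛ m → Bi+gi i g ≡ true → Bi+gi j g ≡ true → i ≡ j
  Bᵢ+gᵢ-disjoint {i} {j} g<m g∈ᵢ g∈ⱼ with i ≟ j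
  ... | yes i≡j = i≡j
  ... | no i≢j with Bᵢ+gᵢ⁻ i g<m g∈ᵢ | Bᵢ+gᵢ⁻ j g<m g∈ⱼ
  ...   | k , _ , g≗βᵢ | l , _ , g≗βⱼ = cases (p j ≟ i)
    where
    coordinate-i : 1 + k * u i ≡ β u j l i
    coordinate-i = begin
      1 + k * u i                 ≡⟨ ≡.sym (β⊕g-at-i i k) ⟩
      (β u i k ⊕ᵉ unit i) i       ≡⟨ ≡.trans (≡.sym (g≗βᵢ i)) (g≗βⱼ i) ⟩
      β u j l i + unit j i        ≡⟨ ≡.cong (β u j l i +_) (unit-off (i≢j ∘ ≡.sym)) ⟩
      β u j l i + 0               ≡⟨ ℕ.+-identityʳ _ ⟩
      β u j l i                   ∎
      where open ≡.≡-Reasoning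
    cases : Dec (p j ≡ i) → i ≡ j
    cases (yes ≡.refl) = contradiction (residue-unique {u i} k 1 (hu i) (ℕ.>-nonZero⁻¹ (u i))
      (≡.trans coordinate-i (≡.trans (β-at-pi u j l) (≡.sym (ℕ.*-identityˡ (u i)))))) λ ()
    cases (no pj≢i) = contradiction (≡.trans coordinate-i (β-elsewhere u j l (i≢j ∘ ≡.sym) pj≢i)) λ ()

  module IndicatorSums (R : CommutativeRing 0ℓ 0ℓ) where
    open CommutativeRing R renaming (_+_ to _+ᴿ_)
    open ListSum R
    open Summation R
    open import Algebra.Properties.Group +-group using (∙-cancelʳ)
    open import Relation.Binary.Reasoning.Setoid setoid

    indicator-∪-∖ : ∀ P C S {c} → (S ≡ true → P ≡ true) → (P ≡ true → C ≡ false) →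
      (if (P ∨ C) ∧ not S then c else 0#) +ᴿ (if S then c else 0#) ≈ (if P then c else 0#) +ᴿ (if C then c else 0#)
    indicator-∪-∖ true  true  _     _   P⇒C≡false = contradiction (P⇒C≡false ≡.refl) λ ()
    indicator-∪-∖ true  false true  _   _         = trans (+-identityˡ _) (sym (+-identityʳ _))
    indicator-∪-∖ true  false false _   _         = refl
    indicator-∪-∖ false _     true  S⇒P _         = contradiction (S⇒P ≡.refl) λ ()
    indicator-∪-∖ false true  false _   _         = trans (+-identityʳ _) (sym (+-identityˡ _))
    indicator-∪-∖ false false false _   _         = refl

    B-indicator : ∀ {g} → g <ᵛ m → (c : Carrier) →
      (if B g then c else 0#) +ᴿ ∑ (allFin r) (λ i → if Bi i g then c else 0#) ≈
      (if B′ g then c else 0#) +ᴿ ∑ (allFin r) (λ i → if Bi+gi i g then c else 0#)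
    B-indicator {g} g<m c = begin
      (if B g then c else 0#) +ᴿ ∑ (allFin r) (λ i → if Bi i g then c else 0#)
        ≈⟨ +-congˡ (∑-if-unique (allFin r) (λ i → Bi i g) c (allFin⁺ r) (Bᵢ-disjoint g<m)) ⟩
      (if B g then c else 0#) +ᴿ (if any (λ i → Bi i g) (allFin r) then c else 0#)
        ≈⟨ indicator-∪-∖ (B′ g) _ _ ⋃Bᵢ⊆B′ B′∩⋃Bᵢ+gᵢ ⟩
      (if B′ g then c else 0#) +ᴿ (if any (λ i → Bi+gi i g) (allFin r) then c else 0#)
        ≈⟨ +-congˡ (∑-if-unique (allFin r) (λ i → Bi+gi i g) c (allFin⁺ r) (Bᵢ+gᵢ-disjoint g<m)) ⟨
      (if B′ g then c else 0#) +ᴿ ∑ (allFin r) (λ i → if Bi+gi i g then c else 0#) ∎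
      where
      ⋃Bᵢ⊆B′ : any (λ i → Bi i g) (allFin r) ≡ true → B′ g ≡ true
      ⋃Bᵢ⊆B′ g∈⋃ with any≡true⁻ (λ i → Bi i g) (allFin r) g∈⋃
      ... | i , _ , g∈Bᵢ = Bᵢ⊆B′ i g<m g∈Bᵢ
      B′∩⋃Bᵢ+gᵢ : B′ g ≡ true → any (λ i → Bi+gi i g) (allFin r) ≡ false
      B′∩⋃Bᵢ+gᵢ g∈B′ with any (λ i → Bi+gi i g) (allFin r) in g∈⋃
      ... | false = ≡.refl
      ... | true with any≡true⁻ (λ i → Bi+gi i g) (allFin r) g∈⋃
      ...   | i , _ , g∈Bᵢ+gᵢ = contradiction (≡.trans (≡.sym g∈B′) (Bᵢ+gᵢ∩B′ i g<m g∈Bᵢ+gᵢ)) λ ()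

    sumOver-B : ∀ f → sumOver R B f +ᴿ ∑ (allFin r) (λ i → sumOver R (Bi i) f) ≈
                      sumOver R B′ f +ᴿ ∑ (allFin r) (λ i → sumOver R (Bi+gi i) f)
    sumOver-B f = begin
      sumOver R B f +ᴿ ∑ (allFin r) (λ i → sumOver R (Bi i) f)
        ≈⟨ +-congˡ (∑-swap (allFin r) allG (λ i g → if Bi i g then f g else 0#)) ⟩
      sumOver R B f +ᴿ ∑ allG (λ g → ∑ (allFin r) (λ i → if Bi i g then f g else 0#))
        ≈⟨ ∑-+ allG _ _ ⟨
      ∑ allG (λ g → (if B g then f g else 0#) +ᴿ ∑ (allFin r) (λ i → if Bi i g then f g else 0#))
        ≈⟨ ∑-cong allG (λ g∈allG → B-indicator (∈-enum⁻ r m g∈allG) _) ⟩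
      ∑ allG (λ g → (if B′ g then f g else 0#) +ᴿ ∑ (allFin r) (λ i → if Bi+gi i g then f g else 0#))
        ≈⟨ ∑-+ allG _ _ ⟩
      sumOver R B′ f +ᴿ ∑ allG (λ g → ∑ (allFin r) (λ i → if Bi+gi i g then f g else 0#))
        ≈⟨ +-congˡ (∑-swap (allFin r) allG (λ i g → if Bi+gi i g then f g else 0#)) ⟨
      sumOver R B′ f +ᴿ ∑ (allFin r) (λ i → sumOver R (Bi+gi i) f) ∎

    sumOver-B≈sumOver-B′ : ∀ f → (∀ i → sumOver R (Bi+gi i) f ≈ sumOver R (Bi i) f) → sumOver R B f ≈ sumOver R B′ f
    sumOver-B≈sumOver-B′ f Bᵢ+gᵢ≈Bᵢ =
      ∙-cancelʳ _ _ _ (trans (sumOver-B f) (+-congˡ (∑-cong (allFin r) (λ {i} _ → Bᵢ+gᵢ≈Bᵢ i))))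

    sumOver-Bᵢ : ∀ i f → f Preserves _≗_ ⟶ _≈_ → sumOver R (Bi i) f ≈ ∑ (upTo (v i)) (f ∘ β u i)
    sumOver-Bᵢ i f f-cong = trans (sumOver-fromList (Bᵢ-canonical i) f f-cong) (reflexive (∑-map (β u i) (upTo (v i)) f))

    sumOver-Bᵢ+gᵢ : ∀ i f → f Preserves _≗_ ⟶ _≈_ →
      sumOver R (Bi+gi i) f ≈ ∑ (upTo (v i)) (λ k → f (β u i k ⊕ᵉ unit i))
    sumOver-Bᵢ+gᵢ i f f-cong = begin
      sumOver R (Bi+gi i) f                         ≈⟨ sumOver-fromList (Bᵢ+gᵢ-canonical i) f f-cong ⟩
      ∑ (map (_⊕ᵉ unit i) (Blist i)) f              ≡⟨ ∑-map (_⊕ᵉ unit i) (Blist i) f ⟩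
      ∑ (Blist i) (λ x → f (x ⊕ᵉ unit i))            ≡⟨ ∑-map (β u i) (upTo (v i)) _ ⟩
      ∑ (upTo (v i)) (λ k → f (β u i k ⊕ᵉ unit i))   ∎

  module _ (R : CommutativeRing 0ℓ 0ℓ) (integral : IntegralDomain R)
           (ζ : CommutativeRing.Carrier R) (prim : PrimitiveRoot R ζ) where
    open CommutativeRing R renaming (_+_ to _+ᴿ_; _*_ to _*ᴿ_)
    open ListSum R
    open Characters R integral ζ prim
    open Orthogonality R integral ζ prim
    open IndicatorSums R
    open import Algebra.Definitions.RawSemiring (Algebra.Bundles.Semiring.rawSemiring semiring) using (_^_)
    open import Algebra.Properties.Semiring.Exp semiring using (^-congʳ)
    open import Relation.Binary.Reasoning.Setoid setoid

    χ-β : ∀ l l' i k → χ l l' (β u i k) ≈ χ l l' (u (p i) ·ᵉ unit (p i)) *ᴿ ζ ^ (Q i * (u i * δ l l' i) * k)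
    χ-β l l' i k = begin
      χ l l' (β u i k)                                  ≈⟨ χ-+ l l' x y ⟩
      χ l l' x *ᴿ χ l l' y                              ≈⟨ *-comm _ _ ⟩
      χ l l' y *ᴿ χ l l' x                              ≈⟨ *-congˡ (^-congʳ ζ pairExp-x) ⟩
      χ l l' y *ᴿ ζ ^ (Q i * (u i * δ l l' i) * k)      ∎
      where
      x = (k * u i) ·ᵉ unit i
      y = u (p i) ·ᵉ unit (p i)
      shuffle : ∀ q k a d → q * (k * a * 1 * d) ≡ q * (a * d) * k
      shuffle = solve-∀
      pairExp-x : pairExp x l l' ≡ Q i * (u i * δ l l' i) * k
      pairExp-x = ≡.trans
        (pairExp-single x l l' i (λ j j≢i → ≡.trans (≡.cong (k * u i *_) (unit-off (j≢i ∘ ≡.sym))) (ℕ.*-zeroʳ (k * u i))))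
        (≡.trans (≡.cong (λ e → Q i * (k * u i * e * δ l l' i)) (unit-diag i)) (shuffle (Q i) k (u i) (δ l l' i)))

    χ-unit≈1 : ∀ {l l' i} → l' <ᵛ m → l i ≡ l' i → χ l l' (unit i) ≈ 1#
    χ-unit≈1 l'<m lᵢ≡l'ᵢ = ζ^-∣ (N∣pairExp-unit l'<m lᵢ≡l'ᵢ)

    ∑-Bᵢ-χ≈0 : ∀ {l l' i} → l <ᵛ v → l' <ᵛ v → l i ≢ l' i → ∑ (upTo (v i)) (χ l l' ∘ β u i) ≈ 0#
    ∑-Bᵢ-χ≈0 {l} {l'} {i} l<v l'<v lᵢ≢l'ᵢ = begin
      ∑ (upTo (v i)) (χ l l' ∘ β u i)          ≈⟨ ∑-cong (upTo (v i)) (λ {k} _ → χ-β l l' i k) ⟩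
      ∑ (upTo (v i)) (λ k → c *ᴿ ζ ^ (e * k))  ≈⟨ ∑-*ˡ (upTo (v i)) c _ ⟩
      c *ᴿ ∑ (upTo (v i)) (λ k → ζ ^ (e * k))  ≈⟨ *-congˡ (∑-character≈0 i {a = u i} ≡.refl (v∤δ i l<v l'<v lᵢ≢l'ᵢ)) ⟩
      c *ᴿ 0#                                  ≈⟨ zeroʳ c ⟩
      0#                                       ∎
      where
      c = χ l l' (u (p i) ·ᵉ unit (p i))
      e = Q i * (u i * δ l l' i)

    sumOver-Bᵢ+gᵢ-χ : ∀ {l l'} i → l <ᵛ v → l' <ᵛ v → sumOver R (Bi+gi i) (χ l l') ≈ sumOver R (Bi i) (χ l l')
    sumOver-Bᵢ+gᵢ-χ {l} {l'} i l<v l'<v = begin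
      sumOver R (Bi+gi i) (χ l l')                       ≈⟨ sumOver-Bᵢ+gᵢ i (χ l l') (χ-cong l l') ⟩
      ∑ (upTo (v i)) (λ k → χ l l' (β u i k ⊕ᵉ unit i))
        ≈⟨ ∑-cong (upTo (v i)) (λ {k} _ → trans (χ-+ l l' (β u i k) (unit i)) (*-comm _ _)) ⟩
      ∑ (upTo (v i)) (λ k → χₑ *ᴿ χ l l' (β u i k))      ≈⟨ ∑-*ˡ (upTo (v i)) χₑ _ ⟩
      χₑ *ᴿ ∑ (upTo (v i)) (χ l l' ∘ β u i)              ≈⟨ cases (l i ℕ.≟ l' i) ⟩
      ∑ (upTo (v i)) (χ l l' ∘ β u i)                    ≈⟨ sumOver-Bᵢ i (χ l l') (χ-cong l l') ⟨
      sumOver R (Bi i) (χ l l')                          ∎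
      where
      χₑ = χ l l' (unit i)
      cases : Dec (l i ≡ l' i) → χₑ *ᴿ ∑ (upTo (v i)) (χ l l' ∘ β u i) ≈ ∑ (upTo (v i)) (χ l l' ∘ β u i)
      cases (yes lᵢ≡l'ᵢ) = trans (*-congʳ (χ-unit≈1 (<v⇒<m l'<v) lᵢ≡l'ᵢ)) (*-identityˡ _)
      cases (no lᵢ≢l'ᵢ)  = trans (*-congˡ S≈0) (trans (zeroʳ χₑ) (sym S≈0))
        where S≈0 = ∑-Bᵢ-χ≈0 l<v l'<v lᵢ≢l'ᵢ

    B-orthogonal : Orthogonal R ζ B ΛB
    B-orthogonal = orthogonal⁺ B ΛB λ {l} {l'} l<m l'<m l∈ l'∈ l≉l' →
      let l<v = ΛB⁻ l<m l∈ ; l'<v = ΛB⁻ l'<m l'∈ in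
      trans (sumOver-B≈sumOver-B′ (χ l l') (λ i → sumOver-Bᵢ+gᵢ-χ i l<v l'<v)) (sumOver-B′-χ≈0 l<v l'<v l≉l')

  card-B′≡card-B : card B′ ≡ card B
  card-B′≡card-B = card-≡ B′ B (≡.sym (sumOver-B≈sumOver-B′ one (λ i →
    ≡.trans (sumOver-Bᵢ+gᵢ i one (λ _ → ≡.refl)) (≡.sym (sumOver-Bᵢ i one (λ _ → ≡.refl))))))
    where
    open IndicatorSums ℤ-ring
    one : Elt r → ℤ
    one _ = 1ℤ

proposition3p4 : (r : ℕ) → 3 ≤ r → (u v : Vector ℕ r) → (hu : ∀ i → 1 < u i) → (hv : ∀ i → 1 < v i) →
    (π : Permutation′ r) → NoShortCycles π →
      let open Sets r u v π (nzProd u v hu hv) in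
      Spectral A ΛA × Spectral B′ ΛB × Spectral B ΛB × DirectSumIsG ΛA ΛB
proposition3p4 r _ u v hu hv π no-short-cycles =
  (card-ΛA≡card-A , λ R integral _ ζ prim → A-orthogonal R integral ζ prim) ,
  (card-ΛB≡card-B′ , λ R integral _ ζ prim → B′-orthogonal R integral ζ prim) ,
  (≡.trans card-ΛB≡card-B′ card-B′≡card-B , λ R integral _ ζ prim → B-orthogonal R integral ζ prim) ,
  ΛA⊕ΛB≡G
  where
  open ProductSets r u v hu hv π
  open ProductSets.Orthogonality r u v hu hv π
  open ShiftedSet r u v hu hv π no-short-cycles
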